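{- A necklace graph $G$ has a star cutset if and only if it has a short bead.
   Context: Connecting two vertices by a path of length $0$ means identifying them. Let $m\ge 2$ and let $B_1,\dots,B_m$ be vertex-disjoint cycles, each of length at least $4$. For each $i$, let $a_i,b_i$ be two non-adjacent vertices of $B_i$. For $1\le i\le m$, connect $b_i$ and $a_{i+1}$ (with $a_{m+1}=a_1$) by a path of length at least $0$ whose internal vertices are new. The resulting graph is an $m$-necklace; a necklace is an $m$-necklace for some $m\ge 2$; the $B_i$ are its beads. A bead $B_i$ is short if $a_i$ and $b_i$ have a common neighbor. A star cutset of a graph $G$ is a set $S\subseteq V(G)$ such that $G\setminus S$ is disconnected and some vertex of $S$ is adjacent to all other vertices of $S$. -}

module Defs where

open import Data.Nat using (ℕ; zero; suc; _≤_; _<_)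
open import Data.Fin using (Fin; zero; suc; toℕ; fromℕ)
open import Data.Bool using (Bool; true; false)
open import Data.Product using (Σ; Σ-syntax; ∃; ∃-syntax; _×_; _,_)
open import Data.Sum using (_⊎_)
open import Data.Empty using (⊥)
open import Relation.Binary.PropositionalEquality using (_≡_; _≢_)
open import Relation.Nullary using (¬_)
open import Data.Fin.Subset using (Subset; _∈_; _∉_)

record Graph (n : ℕ) : Set where
  field
    adj    : Fin n → Fin n → Bool
    sym    : ∀ u v → adj u v ≡ adj v u
    irrefl : ∀ u → adj u u ≡ false

Edge : ∀ {n} → Graph n → Fin n → Fin n → Set
Edge G u v = Graph.adj G u v ≡ true

-- Connectivity in G \ S : walks all of whose vertices avoid S
-- (the start vertex is required to avoid S separately, below).

data ConnectedIn {n} (G : Graph n) (S : Subset n) : Fin n → Fin n → Set where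
  here : ∀ {u} → ConnectedIn G S u u
  step : ∀ {u v w} → Edge G u v → v ∉ S → ConnectedIn G S v w → ConnectedIn G S u w

Disconnected∖ : ∀ {n} → Graph n → Subset n → Set
Disconnected∖ {n} G S =
  Σ[ u ∈ Fin n ] Σ[ v ∈ Fin n ] (u ∉ S × v ∉ S × ¬ ConnectedIn G S u v)

IsStarCutset : ∀ {n} → Graph n → Subset n → Set
IsStarCutset {n} G S =
  Disconnected∖ G S ×
  (Σ[ x ∈ Fin n ] (x ∈ S × (∀ y → y ∈ S → y ≢ x → Edge G x y)))

HasStarCutset : ∀ {n} → Graph n → Set
HasStarCutset {n} G = Σ[ S ∈ Subset n ] IsStarCutset G S

CycSucc : ∀ {ℓ} → Fin ℓ → Fin ℓ → Set
CycSucc {ℓ} i j = (suc (toℕ i) ≡ toℕ j) ⊎ (suc (toℕ i) ≡ ℓ × toℕ j ≡ 0)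

-- A necklace structure on G: G is (isomorphic to) the graph obtained
-- from vertex-disjoint cycles B_0,…,B_{m-1} (bead i has vertices
-- bead i 0, …, bead i (ℓ i - 1) in cyclic order) by joining
-- b_i = bead i (b i) to a_{i+1} = bead (i+1 mod m) (a (i+1)) by a path
-- path i 0, …, path i (p i) with new internal vertices (p i = 0 means
-- b_i and a_{i+1} are identified).

record Necklace {n : ℕ} (G : Graph n) : Set where
  field
    m     : ℕ
    m≥2   : 2 ≤ m
    ℓ     : Fin m → ℕ
    ℓ≥4   : ∀ i → 4 ≤ ℓ i
    bead  : (i : Fin m) → Fin (ℓ i) → Fin n
    a     : (i : Fin m) → Fin (ℓ i)
    b     : (i : Fin m) → Fin (ℓ i)
    a≢b       : ∀ i → a i ≢ b i
    ¬succ-ab  : ∀ i → ¬ CycSucc (a i) (b i)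
    ¬succ-ba  : ∀ i → ¬ CycSucc (b i) (a i)
    p     : Fin m → ℕ
    path  : (i : Fin m) → Fin (suc (p i)) → Fin n
    path-start : ∀ i → path i zero ≡ bead i (b i)
    path-end   : ∀ i j → CycSucc i j → path i (fromℕ (p i)) ≡ bead j (a j)
    bead-ident : ∀ i j (k : Fin (ℓ i)) (k' : Fin (ℓ j)) → bead i k ≡ bead j k' →
      (i ≡ j × toℕ k ≡ toℕ k')
      ⊎ (CycSucc i j × p i ≡ 0 × k ≡ b i × k' ≡ a j)
      ⊎ (CycSucc j i × p j ≡ 0 × k' ≡ b j × k ≡ a i)
    internal-new : ∀ i (t : Fin (suc (p i))) → 0 < toℕ t → toℕ t < p i →
      ∀ j (k : Fin (ℓ j)) → path i t ≢ bead j k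
    internal-inj : ∀ i (t : Fin (suc (p i))) j (t' : Fin (suc (p j))) →
      0 < toℕ t → toℕ t < p i → 0 < toℕ t' → toℕ t' < p j →
      path i t ≡ path j t' → i ≡ j × toℕ t ≡ toℕ t'
    covers : ∀ v → (Σ[ i ∈ Fin m ] Σ[ k ∈ Fin (ℓ i) ] bead i k ≡ v)
                 ⊎ (Σ[ i ∈ Fin m ] Σ[ t ∈ Fin (suc (p i)) ] path i t ≡ v)
    edges-sound : ∀ u v → Edge G u v →
        (Σ[ i ∈ Fin m ] Σ[ k ∈ Fin (ℓ i) ] Σ[ k' ∈ Fin (ℓ i) ]
           (CycSucc k k' × ((bead i k ≡ u × bead i k' ≡ v) ⊎ (bead i k ≡ v × bead i k' ≡ u))))
      ⊎ (Σ[ i ∈ Fin m ] Σ[ t ∈ Fin (suc (p i)) ] Σ[ t' ∈ Fin (suc (p i)) ]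
           (suc (toℕ t) ≡ toℕ t' × ((path i t ≡ u × path i t' ≡ v) ⊎ (path i t ≡ v × path i t' ≡ u))))
    bead-edge : ∀ i (k k' : Fin (ℓ i)) → CycSucc k k' → Edge G (bead i k) (bead i k')
    path-edge : ∀ i (t t' : Fin (suc (p i))) → suc (toℕ t) ≡ toℕ t' → Edge G (path i t) (path i t')

  aᵥ : Fin m → Fin n
  aᵥ i = bead i (a i)

  bᵥ : Fin m → Fin n
  bᵥ i = bead i (b i)

IsShortBead : ∀ {n} {G : Graph n} (N : Necklace G) → Fin (Necklace.m N) → Set
IsShortBead {n} {G} N i =
  Σ[ w ∈ Fin n ] (Edge G (Necklace.aᵥ N i) w × Edge G w (Necklace.bᵥ N i))

HasShortBead : ∀ {n} {G : Graph n} → Necklace G → Set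
HasShortBead N = Σ[ i ∈ Fin (Necklace.m N) ] IsShortBead N i

module Submission where

-- If the bead B_i is short, with a_i – w – b_i, then {w, a_i, b_i} is a star cutset centred at w:
-- it separates the interior of an arc of B_i between a_i and b_i that avoids w from the rest.
--
-- Conversely, let S be a star cutset with centre x and suppose that no bead is short. The two
-- arcs of each bead and each link path are paths whose internal vertices have degree two and
-- whose ends are non-adjacent with no common neighbour off the path. So S ⊆ N[x] cannot block
-- such a path on both sides of a vertex outside S, and every vertex outside S reaches a terminal
-- a_j or b_j outside S. Two free terminals split the cyclic sequence a_1, b_1, a_2, b_2, … into
-- two intervals; if S blocked both, S, which is connected through x and cannot step over a free
-- terminal, would meet both intervals. To make this precise the necklace is unrolled onto its
-- infinite cyclic cover, where every edge changes the height by at most one, or by two across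
-- a terminal.

open import Defs
open import Data.Bool using (true)
open import Data.Bool.Properties using () renaming (_≟_ to _≟ᵇ_)
open import Data.Empty using (⊥; ⊥-elim)
open import Data.Fin using (Fin; toℕ; fromℕ; fromℕ<) renaming (zero to fzero)
open import Data.Fin.Properties using (toℕ-injective; toℕ<n; toℕ-fromℕ<; toℕ-fromℕ; any?) renaming (_≟_ to _≟ᶠ_)
open import Data.Fin.Subset using (Subset; _∈_; _∉_; ⁅_⁆; _∪_)
open import Data.Fin.Subset.Properties using (_∈?_; x∈⁅x⁆; x∈⁅y⁆⇒x≡y; x∈p∪q⁻; p⊆p∪q; q⊆p∪q)
open import Data.Nat using (ℕ; zero; suc; _+_; _*_; _∸_; _≤_; _<_; z≤n; s≤s; _≤?_; _<?_)
open import Data.Nat.Properties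
open import Data.Nat.Tactic.RingSolver using (solve-∀)
open import Data.Product using (Σ; Σ-syntax; _×_; _,_; proj₁; proj₂; swap)
open import Data.Sum using (_⊎_; inj₁; inj₂; [_,_]′) renaming (swap to swap⊎)
open import Function using (_∘_)
open import Function.Bundles using (_⇔_; mk⇔)
open import Relation.Binary using (tri<; tri≈; tri>)
open import Relation.Binary.PropositionalEquality
open import Relation.Nullary using (¬_; Dec; yes; no; contradiction)
open import Relation.Nullary.Decidable using (_×-dec_)
open import Relation.Unary using (Decidable)
open ≡-Reasoning

Edge-sym : ∀ {n} (G : Graph n) {u v} → Edge G u v → Edge G v u
Edge-sym G {u} {v} e = trans (Graph.sym G v u) e

module _ {n} {G : Graph n} {S : Subset n} where

  connected-trans : ∀ {u v w} → ConnectedIn G S u v → ConnectedIn G S v w → ConnectedIn G S u w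
  connected-trans here q = q
  connected-trans (step e v∉S p) q = step e v∉S (connected-trans p q)

  connected-snoc : ∀ {u v w} → ConnectedIn G S u v → Edge G v w → w ∉ S → ConnectedIn G S u w
  connected-snoc p e w∉S = connected-trans p (step e w∉S here)

  connected-sym : ∀ {u v} → u ∉ S → ConnectedIn G S u v → ConnectedIn G S v u
  connected-sym u∉S here = here
  connected-sym u∉S (step e v∉S p) = connected-snoc (connected-sym v∉S p) (Edge-sym G e) u∉S

module _ {ℓ : ℕ} where

  CycSucc-irrefl : 2 ≤ ℓ → (i : Fin ℓ) → ¬ CycSucc i i
  CycSucc-irrefl _ i (inj₁ eq) = 1+n≢n eq
  CycSucc-irrefl ℓ≥2 i (inj₂ (eq₁ , eq₂)) = <⇒≱ ℓ≥2 (≤-reflexive (trans (sym eq₁) (cong suc eq₂)))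

  CycSucc-functional : {i j j' : Fin ℓ} → CycSucc i j → CycSucc i j' → j ≡ j'
  CycSucc-functional (inj₁ e) (inj₁ e') = toℕ-injective (trans (sym e) e')
  CycSucc-functional {j = j} (inj₁ e) (inj₂ (e' , _)) = contradiction (trans (sym e) e') (<⇒≢ (toℕ<n j))
  CycSucc-functional {j' = j'} (inj₂ (e , _)) (inj₁ e') = contradiction (trans (sym e') e) (<⇒≢ (toℕ<n j'))
  CycSucc-functional (inj₂ (_ , e)) (inj₂ (_ , e')) = toℕ-injective (trans e (sym e'))

  CycSucc-injective : {i i' j : Fin ℓ} → CycSucc i j → CycSucc i' j → i ≡ i'
  CycSucc-injective (inj₁ e) (inj₁ e') = toℕ-injective (suc-injective (trans e (sym e')))
  CycSucc-injective (inj₁ e) (inj₂ (_ , e')) = contradiction (trans e e') λ ()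
  CycSucc-injective (inj₂ (_ , e)) (inj₁ e') = contradiction (trans e' e) λ ()
  CycSucc-injective (inj₂ (e , _)) (inj₂ (e' , _)) = toℕ-injective (suc-injective (trans e (sym e')))

csuc : ∀ {ℓ} → Fin ℓ → Fin ℓ
csuc {suc ℓ} i with suc (toℕ i) <? suc ℓ
... | yes lt = fromℕ< lt
... | no _ = fzero

CycSucc-csuc : ∀ {ℓ} (i : Fin ℓ) → CycSucc i (csuc i)
CycSucc-csuc {suc ℓ} i with suc (toℕ i) <? suc ℓ
... | yes lt = inj₁ (sym (toℕ-fromℕ< lt))
... | no ≮ = inj₂ (≤-antisym (toℕ<n i) (≮⇒≥ ≮) , refl)

toℕ-csuc : ∀ {ℓ} (i : Fin ℓ) → suc (toℕ i) < ℓ → toℕ (csuc i) ≡ suc (toℕ i)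
toℕ-csuc i lt with CycSucc-csuc i
... | inj₁ e = sym e
... | inj₂ (e , _) = contradiction e (<⇒≢ lt)

toℕ-csuc-wrap : ∀ {ℓ} (i : Fin ℓ) → suc (toℕ i) ≡ ℓ → toℕ (csuc i) ≡ 0
toℕ-csuc-wrap i eq with CycSucc-csuc i
... | inj₁ e = contradiction (trans (sym e) eq) (<⇒≢ (toℕ<n (csuc i)))
... | inj₂ (_ , e) = e

csuc^ : ∀ {ℓ} → ℕ → Fin ℓ → Fin ℓ
csuc^ zero k = k
csuc^ (suc t) k = csuc (csuc^ t k)

toℕ-csuc^ : ∀ {ℓ} (k : Fin ℓ) t → toℕ k + t < ℓ → toℕ (csuc^ t k) ≡ toℕ k + t
toℕ-csuc^ k zero _ = sym (+-identityʳ (toℕ k))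
toℕ-csuc^ {ℓ} k (suc t) k+t<ℓ =
  begin
    toℕ (csuc (csuc^ t k)) ≡⟨ toℕ-csuc (csuc^ t k) (subst (λ z → suc z < ℓ) (sym ih) k+t<ℓ′) ⟩
    suc (toℕ (csuc^ t k))  ≡⟨ cong suc ih ⟩
    suc (toℕ k + t)        ≡⟨ +-suc (toℕ k) t ⟨
    toℕ k + suc t          ∎
  where
    k+t<ℓ′ : suc (toℕ k + t) < ℓ
    k+t<ℓ′ = subst (_< ℓ) (+-suc (toℕ k) t) k+t<ℓ
    ih : toℕ (csuc^ t k) ≡ toℕ k + t
    ih = toℕ-csuc^ k t (<-trans (n<1+n _) k+t<ℓ′)

toℕ-csuc^-wrap : ∀ {ℓ} (k : Fin ℓ) t → t ≤ ℓ → ℓ ≤ toℕ k + t → toℕ (csuc^ t k) + ℓ ≡ toℕ k + t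
toℕ-csuc^-wrap k zero _ ℓ≤k = contradiction (subst (_ ≤_) (+-identityʳ _) ℓ≤k) (<⇒≱ (toℕ<n k))
toℕ-csuc^-wrap {ℓ} k (suc t) t<ℓ ℓ≤k+st with ℓ ≤? toℕ k + t
... | yes ℓ≤k+t =
  begin
    toℕ (csuc v) + ℓ    ≡⟨ cong (_+ ℓ) (toℕ-csuc v sv<ℓ) ⟩
    suc (toℕ v + ℓ)     ≡⟨ cong suc ih ⟩
    suc (toℕ k + t)     ≡⟨ +-suc (toℕ k) t ⟨
    toℕ k + suc t       ∎
  where
    v = csuc^ t k
    ih : toℕ v + ℓ ≡ toℕ k + t
    ih = toℕ-csuc^-wrap k t (<⇒≤ t<ℓ) ℓ≤k+t
    sv<ℓ : suc (toℕ v) < ℓ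
    sv<ℓ = +-cancelʳ-< ℓ (suc (toℕ v)) ℓ
             (subst (_< ℓ + ℓ) (trans (+-suc (toℕ k) t) (cong suc (sym ih)))
               (+-mono-<-≤ (toℕ<n k) t<ℓ))
... | no ℓ≰k+t =
  begin
    toℕ (csuc v) + ℓ    ≡⟨ cong (_+ ℓ) (toℕ-csuc-wrap v (trans (cong suc v≡k+t) sk+t≡ℓ)) ⟩
    ℓ                   ≡⟨ sk+t≡ℓ ⟨
    suc (toℕ k + t)     ≡⟨ +-suc (toℕ k) t ⟨
    toℕ k + suc t       ∎
  where
    v = csuc^ t k
    v≡k+t : toℕ v ≡ toℕ k + t
    v≡k+t = toℕ-csuc^ k t (≰⇒> ℓ≰k+t)
    sk+t≡ℓ : suc (toℕ k + t) ≡ ℓ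
    sk+t≡ℓ = ≤-antisym (≰⇒> ℓ≰k+t) (subst (ℓ ≤_) (+-suc (toℕ k) t) ℓ≤k+st)

csuc^-+ : ∀ {ℓ} s t (k : Fin ℓ) → csuc^ (s + t) k ≡ csuc^ s (csuc^ t k)
csuc^-+ zero t k = refl
csuc^-+ (suc s) t k = cong csuc (csuc^-+ s t k)

csuc^-period : ∀ {ℓ} (k : Fin ℓ) → csuc^ ℓ k ≡ k
csuc^-period {ℓ} k = toℕ-injective (+-cancelʳ-≡ ℓ _ _ (toℕ-csuc^-wrap k ℓ ≤-refl (m≤n+m ℓ (toℕ k))))

csuc^-aperiodic : ∀ {ℓ} (k : Fin ℓ) s → 0 < s → s < ℓ → csuc^ s k ≢ k
csuc^-aperiodic {ℓ} k s 0<s s<ℓ eq with toℕ k + s <? ℓ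
... | yes k+s<ℓ = <⇒≢ (m<m+n (toℕ k) 0<s) (trans (sym (cong toℕ eq)) (toℕ-csuc^ k s k+s<ℓ))
... | no k+s≮ℓ = <⇒≢ s<ℓ (sym (+-cancelˡ-≡ (toℕ k) ℓ s
                    (trans (cong (_+ ℓ) (sym (cong toℕ eq))) (toℕ-csuc^-wrap k s (<⇒≤ s<ℓ) (≮⇒≥ k+s≮ℓ)))))

csuc^-<-distinct : ∀ {ℓ} (k : Fin ℓ) {s t} → s < t → t < ℓ → csuc^ s k ≢ csuc^ t k
csuc^-<-distinct k {s} {t} s<t t<ℓ eq =
  csuc^-aperiodic (csuc^ s k) (t ∸ s) (m<n⇒0<n∸m s<t) (≤-<-trans (m∸n≤m t s) t<ℓ) (begin
    csuc^ (t ∸ s) (csuc^ s k) ≡⟨ csuc^-+ (t ∸ s) s k ⟨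
    csuc^ (t ∸ s + s) k       ≡⟨ cong (λ r → csuc^ r k) (m∸n+n≡m (<⇒≤ s<t)) ⟩
    csuc^ t k                 ≡⟨ eq ⟨
    csuc^ s k                 ∎)

csuc^-injective : ∀ {ℓ} (k : Fin ℓ) {s t} → s < ℓ → t < ℓ → csuc^ s k ≡ csuc^ t k → s ≡ t
csuc^-injective k {s} {t} s<ℓ t<ℓ eq with <-cmp s t
... | tri< s<t _ _ = contradiction eq (csuc^-<-distinct k s<t t<ℓ)
... | tri≈ _ s≡t _ = s≡t
... | tri> _ _ t<s = contradiction (sym eq) (csuc^-<-distinct k t<s s<ℓ)

csuc^-surjective : ∀ {ℓ} (k k' : Fin ℓ) → Σ[ t ∈ ℕ ] (t < ℓ × csuc^ t k ≡ k')
csuc^-surjective {ℓ} k k' with toℕ k ≤? toℕ k'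
... | yes k≤k' = toℕ k' ∸ toℕ k , ≤-<-trans (m∸n≤m (toℕ k') (toℕ k)) (toℕ<n k') ,
        toℕ-injective (trans (toℕ-csuc^ k _ (subst (_< ℓ) (sym (m+[n∸m]≡n k≤k')) (toℕ<n k'))) (m+[n∸m]≡n k≤k'))
... | no k≰k' = t , t<ℓ , toℕ-injective (+-cancelʳ-≡ ℓ _ _ (trans (toℕ-csuc^-wrap k t (<⇒≤ t<ℓ) ℓ≤k+t) k+t≡k'+ℓ))
  where
    t = ℓ ∸ toℕ k + toℕ k'
    k+t≡k'+ℓ : toℕ k + t ≡ toℕ k' + ℓ
    k+t≡k'+ℓ = begin
      toℕ k + (ℓ ∸ toℕ k + toℕ k') ≡⟨ +-assoc (toℕ k) _ _ ⟨
      toℕ k + (ℓ ∸ toℕ k) + toℕ k' ≡⟨ cong (_+ toℕ k') (m+[n∸m]≡n (<⇒≤ (toℕ<n k))) ⟩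
      ℓ + toℕ k'                   ≡⟨ +-comm ℓ (toℕ k') ⟩
      toℕ k' + ℓ                   ∎
    ℓ≤k+t : ℓ ≤ toℕ k + t
    ℓ≤k+t = subst (ℓ ≤_) (sym k+t≡k'+ℓ) (m≤n+m ℓ (toℕ k'))
    t<ℓ : t < ℓ
    t<ℓ = +-cancelˡ-< (toℕ k) t ℓ (subst (_< toℕ k + ℓ) (sym k+t≡k'+ℓ) (+-monoˡ-< ℓ (≰⇒> k≰k')))

csuc^-between : ∀ {ℓ} {k k' : Fin ℓ} {D t} → csuc^ D k ≡ k' → D < ℓ → 0 < t → t < D →
                csuc^ t k ≢ k × csuc^ t k ≢ k'
csuc^-between {k = k} {D = D} {t} refl D<ℓ 0<t t<D =
  csuc^-aperiodic k t 0<t (<-trans t<D D<ℓ) ,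
  λ eq → <⇒≢ t<D (csuc^-injective k (<-trans t<D D<ℓ) D<ℓ eq)

csuc^-steps≥2 : ∀ {ℓ} {k k' : Fin ℓ} {t} → k ≢ k' → ¬ CycSucc k k' → csuc^ t k ≡ k' → 2 ≤ t
csuc^-steps≥2 {t = zero} k≢k' _ refl = contradiction refl k≢k'
csuc^-steps≥2 {k = k} {t = suc zero} _ ¬k→k' refl = contradiction (CycSucc-csuc k) ¬k→k'
csuc^-steps≥2 {t = suc (suc t)} _ _ _ = s≤s (s≤s z≤n)

module _ {p} {P : ℕ → Set p} (P? : Decidable P) where

  last-below : ∀ t → (∀ j → j < t → ¬ P j) ⊎ Σ[ s ∈ ℕ ] (s < t × P s × (∀ j → s < j → j < t → ¬ P j))
  last-below zero = inj₁ λ _ ()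
  last-below (suc t) with P? t | last-below t
  ... | yes Pt | _ = inj₂ (t , ≤-refl , Pt , λ j t<j j<st _ → <⇒≱ t<j (≤-pred j<st))
  ... | no ¬Pt | inj₁ none = inj₁ λ j j<st → [ none j , (λ { refl → ¬Pt }) ]′ (m≤n⇒m<n∨m≡n (≤-pred j<st))
  ... | no ¬Pt | inj₂ (s , s<t , Ps , gap) =
        inj₂ (s , m≤n⇒m≤1+n s<t , Ps ,
              λ j s<j j<st → [ gap j s<j , (λ { refl → ¬Pt }) ]′ (m≤n⇒m<n∨m≡n (≤-pred j<st)))

  first-above : ∀ t u → (∀ j → t < j → j ≤ u → ¬ P j)
                        ⊎ Σ[ s ∈ ℕ ] (t < s × s ≤ u × P s × (∀ j → t < j → j < s → ¬ P j))
  first-above t zero = inj₁ λ j t<j j≤0 _ → <⇒≱ t<j (≤-trans j≤0 z≤n)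
  first-above t (suc u) with first-above t u
  ... | inj₂ (s , t<s , s≤u , Ps , gap) = inj₂ (s , t<s , m≤n⇒m≤1+n s≤u , Ps , gap)
  ... | inj₁ none with t <? suc u | P? (suc u)
  ...   | yes t<su | yes Psu = inj₂ (suc u , t<su , ≤-refl , Psu , λ j t<j j<su → none j t<j (≤-pred j<su))
  ...   | yes _ | no ¬Psu =
          inj₁ λ j t<j j≤su → [ none j t<j ∘ ≤-pred , (λ { refl → ¬Psu }) ]′ (m≤n⇒m<n∨m≡n j≤su)
  ...   | no t≮su | _ = inj₁ λ j t<j j≤su _ → t≮su (<-≤-trans t<j j≤su)

*+-unique : ∀ M {w w' r r'} → r < M → r' < M → w * M + r ≡ w' * M + r' → w ≡ w' × r ≡ r'
*+-unique M {zero} {zero} _ _ eq = refl , eq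
*+-unique M {zero} {suc w'} {r' = r'} r<M _ eq =
  contradiction (subst (M ≤_) (sym eq) (≤-trans (m≤m+n M (w' * M)) (m≤m+n _ r'))) (<⇒≱ r<M)
*+-unique M {suc w} {zero} {r} _ r'<M eq =
  contradiction (subst (M ≤_) eq (≤-trans (m≤m+n M (w * M)) (m≤m+n _ r))) (<⇒≱ r'<M)
*+-unique M {suc w} {suc w'} {r} {r'} r<M r'<M eq
  with *+-unique M {w} {w'} r<M r'<M (+-cancelˡ-≡ M _ _ (trans (sym (+-assoc M (w * M) r)) (trans eq (+-assoc M (w' * M) r'))))
... | refl , r≡r' = refl , r≡r'

private
  *+-below : ∀ M P {u u' r} → u < u' → P < u * M + r → P + M ≤ u' * M + r
  *+-below M P {u} {u'} {r} u<u' P< =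
    ≤-trans (+-monoˡ-≤ M (<⇒≤ P<)) (≤-trans (≤-reflexive (shuffle (u * M) r M)) (+-monoˡ-≤ r (*-monoˡ-≤ M u<u')))
    where
      shuffle : ∀ x y z → x + y + z ≡ z + x + y
      shuffle = solve-∀

*+-window : ∀ M P {w w' r} → P < w * M + r → w * M + r < P + M → P < w' * M + r → w' * M + r < P + M → w ≡ w'
*+-window M P {w} {w'} lo hi lo' hi' with <-cmp w w'
... | tri< w<w' _ _ = contradiction (*+-below M P w<w' lo) (<⇒≱ hi')
... | tri≈ _ w≡w' _ = w≡w'
... | tri> _ _ w'<w = contradiction (*+-below M P w'<w lo') (<⇒≱ hi)

Even : ℕ → Set
Even e = Σ[ h ∈ ℕ ] e ≡ h + h

even-split : ∀ {e e'} → Even e → Even e' → e < e' → Σ[ D ∈ ℕ ] (suc D + suc D + e ≡ e')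
even-split (h , refl) (g , refl) e<e' with <-cmp h g
... | tri< h<g _ _ =
  g ∸ suc h , trans (pair (g ∸ suc h) h) (cong (λ z → z + z) (trans (sym (+-suc (g ∸ suc h) h)) (m∸n+n≡m h<g)))
  where pair : ∀ D h → suc D + suc D + (h + h) ≡ suc D + h + (suc D + h)
        pair = solve-∀
... | tri≈ _ refl _ = contradiction e<e' (<-irrefl refl)
... | tri> _ _ g<h = contradiction (+-mono-≤ (<⇒≤ g<h) (<⇒≤ g<h)) (<⇒≱ e<e')

even-< : ∀ {e e'} → Even e → Even e' → e < e' → 2 + e ≤ e'
even-< ev ev' e<e' with even-split ev ev' e<e'
... | D , refl = +-monoˡ-≤ _ (s≤s (subst (1 ≤_) (sym (+-suc D D)) (s≤s z≤n)))

-- The moves an edge of the necklace can make on heights (see Heights below): by at most one,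
-- or by two starting from an even height, which is that of a terminal.
data Near : ℕ → ℕ → Set where
  stay      : ∀ {e} → Near e e
  up        : ∀ {e} → Near e (suc e)
  down      : ∀ {e} → Near (suc e) e
  jump-up   : ∀ {e} → Even e → Near e (2 + e)
  jump-down : ∀ {e} → Even (2 + e) → Near (2 + e) e

Near-within : ∀ {P Q e e'} → Even P → Even Q → P < e → e < Q → Near e e' →
              (P < e' × e' < Q) ⊎ e' ≡ P ⊎ e' ≡ Q
Near-within _ _ P<e e<Q stay = inj₁ (P<e , e<Q)
Near-within _ _ P<e e<Q up with m≤n⇒m<n∨m≡n e<Q
... | inj₁ se<Q = inj₁ (m≤n⇒m≤1+n P<e , se<Q)
... | inj₂ se≡Q = inj₂ (inj₂ se≡Q)
Near-within _ _ P<se e<Q down with m≤n⇒m<n∨m≡n (≤-pred P<se)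
... | inj₁ P<e = inj₁ (P<e , <-trans (n<1+n _) e<Q)
... | inj₂ P≡e = inj₂ (inj₁ (sym P≡e))
Near-within _ evQ P<e e<Q (jump-up ev) with m≤n⇒m<n∨m≡n (even-< ev evQ e<Q)
... | inj₁ 2+e<Q = inj₁ (≤-trans P<e (m≤n+m _ 2) , 2+e<Q)
... | inj₂ 2+e≡Q = inj₂ (inj₂ 2+e≡Q)
Near-within evP _ P<2+e 2+e<Q (jump-down ev) with m≤n⇒m<n∨m≡n (+-cancelˡ-≤ 2 _ _ (even-< evP ev P<2+e))
... | inj₁ P<e = inj₁ (P<e , ≤-trans (m≤n+m _ 2) 2+e<Q)
... | inj₂ P≡e = inj₂ (inj₁ (sym P≡e))

record BarePath {n} (G : Graph n) : Set where
  field
    length : ℕ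
    vertex : ℕ → Fin n
    edge : ∀ {t} → t < length → Edge G (vertex t) (vertex (suc t))
    injective : ∀ {t t'} → t ≤ length → t' ≤ length → vertex t ≡ vertex t' → t ≡ t'
    interior-neighbour : ∀ {t v} → suc t < length → Edge G (vertex (suc t)) v →
                         v ≡ vertex t ⊎ v ≡ vertex (suc (suc t))

  distinct : ∀ {s t} → s < t → t ≤ length → vertex s ≢ vertex t
  distinct s<t t≤L eq = <⇒≢ s<t (injective (≤-trans (<⇒≤ s<t) t≤L) t≤L eq)

module _ {n} {G : Graph n} (S : Subset n) (P : BarePath G) where
  open BarePath P

  walk-up : ∀ {s t} → s ≤ t → t ≤ length → (∀ j → s < j → j ≤ t → vertex j ∉ S) →
            ConnectedIn G S (vertex s) (vertex t)
  walk-up {t = zero} z≤n _ _ = here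
  walk-up {s} {suc t} s≤st st≤L free with m≤n⇒m<n∨m≡n s≤st
  ... | inj₂ refl = here
  ... | inj₁ s<st = connected-snoc (walk-up (≤-pred s<st) (<⇒≤ st≤L) λ j s<j j≤t → free j s<j (m≤n⇒m≤1+n j≤t))
                                   (edge st≤L) (free (suc t) s<st ≤-refl)

  walk-down : ∀ {t} → t ≤ length → vertex t ∉ S → (∀ j → j < t → vertex j ∉ S) →
              ConnectedIn G S (vertex t) (vertex 0)
  walk-down {zero} _ _ _ = here
  walk-down {suc t} t≤L t∉S free =
    connected-sym (free 0 (s≤s z≤n))
      (walk-up z≤n t≤L λ j _ j≤st → [ free j , (λ { refl → t∉S }) ]′ (m≤n⇒m<n∨m≡n j≤st))

  traverse-or-meet : vertex length ∉ S →
    ConnectedIn G S (vertex 0) (vertex length) ⊎ Σ[ t ∈ ℕ ] (0 < t × t < length × vertex t ∈ S)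
  traverse-or-meet L∉S with first-above (λ j → vertex j ∈? S) 0 length
  ... | inj₁ free = inj₁ (walk-up z≤n ≤-refl free)
  ... | inj₂ (t , 0<t , t≤L , t∈S , _) with m≤n⇒m<n∨m≡n t≤L
  ...   | inj₁ t<L = inj₂ (t , 0<t , t<L , t∈S)
  ...   | inj₂ refl = contradiction t∈S L∉S

  Interior : Fin n → Set
  Interior v = Σ[ t ∈ ℕ ] (0 < t × t < length × vertex t ≡ v)

  interior-closed : vertex 0 ∈ S → vertex length ∈ S →
                    ∀ {u v} → ConnectedIn G S u v → Interior u → Interior v
  interior-closed _ _ here u∈I = u∈I
  interior-closed 0∈S L∈S (step e v∉S c) (suc t , _ , st<L , refl) with interior-neighbour st<L e
  ... | inj₁ refl = interior-closed 0∈S L∈S c (back t (<-trans (n<1+n t) st<L) v∉S)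
    where
      back : ∀ t → t < length → vertex t ∉ S → Interior (vertex t)
      back zero _ 0∉S = contradiction 0∈S 0∉S
      back (suc t) st<L _ = suc t , s≤s z≤n , st<L , refl
  ... | inj₂ refl with m≤n⇒m<n∨m≡n st<L
  ...   | inj₁ sst<L = interior-closed 0∈S L∈S c (suc (suc t) , s≤s z≤n , sst<L , refl)
  ...   | inj₂ refl = contradiction L∈S v∉S

  bare-path-separates : vertex 0 ∈ S → vertex length ∈ S → 1 < length → vertex 1 ∉ S →
                        ∀ {v} → v ∉ S → ¬ Interior v → Disconnected∖ G S
  bare-path-separates 0∈S L∈S 1<L 1∉S {v} v∉S v∉I =
    vertex 1 , v , 1∉S , v∉S , λ c → v∉I (interior-closed 0∈S L∈S c (1 , s≤s z≤n , 1<L , refl))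

module _ {n} {G : Graph n} (P : BarePath G) where
  open BarePath P

  EndsNonadjacent : Set
  EndsNonadjacent = 2 ≤ length → ¬ Edge G (vertex 0) (vertex length)

  OnlyMiddleCommonNeighbour : Set
  OnlyMiddleCommonNeighbour =
    2 ≤ length → ∀ y → Edge G y (vertex 0) → Edge G y (vertex length) → y ≡ vertex 1 × length ≡ 2

module _ {n} {G : Graph n} {S : Subset n} {x : Fin n} (x∈S : x ∈ S) (star : ∀ y → y ∈ S → y ≢ x → Edge G x y)
         (P : BarePath G) (ends-nonadjacent : EndsNonadjacent P) (ends-common-neighbour : OnlyMiddleCommonNeighbour P) where
  open BarePath P

  no-chord : ∀ {s t} → 2 + s ≤ t → t ≤ length → ¬ Edge G (vertex s) (vertex t)
  no-chord {suc s} {t} 3+s≤t t≤L e with interior-neighbour (<-≤-trans (m≤n+m (2 + s) 1) (≤-trans 3+s≤t t≤L)) e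
  ... | inj₁ eq = distinct (≤-trans (m≤n+m (suc s) 2) 3+s≤t) t≤L (sym eq)
  ... | inj₂ eq = distinct 3+s≤t t≤L (sym eq)
  no-chord {zero} {t} 2≤t t≤L e with m≤n⇒m<n∨m≡n t≤L
  ... | inj₂ refl = ends-nonadjacent 2≤t e
  no-chord {zero} {suc t} (s≤s 1≤t) _ e | inj₁ st<L with interior-neighbour st<L (Edge-sym G e)
  ... | inj₁ eq = distinct 1≤t (<⇒≤ (<-trans (n<1+n t) st<L)) eq
  ... | inj₂ eq = distinct (s≤s z≤n) st<L eq

  FreeBetween : ℕ → ℕ → Set
  FreeBetween s₁ s₂ = ∀ j → s₁ < j → j < s₂ → vertex j ∉ S

  private
    outside-centre : ∀ {s₁ s₂} → 2 + s₁ ≤ s₂ → s₂ ≤ length → FreeBetween s₁ s₂ →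
                     Edge G x (vertex s₁) → Edge G x (vertex s₂) → ⊥
    outside-centre {suc s} {s₂} gap s₂≤L free e₁ e₂
      with interior-neighbour (<-≤-trans (m≤n+m (2 + s) 1) (≤-trans gap s₂≤L)) (Edge-sym G e₁)
    ... | inj₁ x≡s = no-chord (≤-trans (m≤n+m (2 + s) 1) gap) s₂≤L (subst (λ z → Edge G z (vertex s₂)) x≡s e₂)
    ... | inj₂ x≡ss = free (2 + s) ≤-refl gap (subst (_∈ S) x≡ss x∈S)
    outside-centre {zero} {s₂} gap s₂≤L free e₁ e₂ with m≤n⇒m<n∨m≡n s₂≤L
    ... | inj₂ refl with ends-common-neighbour gap x e₁ e₂
    ...   | x≡1 , L≡2 = free 1 (s≤s z≤n) (subst (1 <_) (sym L≡2) ≤-refl) (subst (_∈ S) x≡1 x∈S)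
    outside-centre {zero} {suc s} (s≤s 1≤s) s₂≤L free e₁ e₂ | inj₁ s₂<L with interior-neighbour s₂<L (Edge-sym G e₂)
    ... | inj₁ x≡s = free s 1≤s ≤-refl (subst (_∈ S) x≡s x∈S)
    ... | inj₂ x≡ss = no-chord (s≤s (s≤s z≤n)) s₂<L (Edge-sym G (subst (λ z → Edge G z (vertex 0)) x≡ss e₁))

  -- The centre x equals or is adjacent to both hits, which gives a chord of the path or a
  -- common neighbour of its ends.
  no-separated-hits : ∀ {s₁ s₂} → 2 + s₁ ≤ s₂ → s₂ ≤ length → vertex s₁ ∈ S → vertex s₂ ∈ S →
                      ¬ FreeBetween s₁ s₂
  no-separated-hits {s₁} {s₂} gap s₂≤L hit₁ hit₂ free with x ≟ᶠ vertex s₁ | x ≟ᶠ vertex s₂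
  ... | yes x≡₁ | yes x≡₂ = distinct (≤-trans (n≤1+n _) gap) s₂≤L (trans (sym x≡₁) x≡₂)
  ... | yes x≡₁ | no x≢₂ =
        no-chord gap s₂≤L (subst (λ z → Edge G z (vertex s₂)) x≡₁ (star _ hit₂ (≢-sym x≢₂)))
  ... | no x≢₁ | yes x≡₂ =
        no-chord gap s₂≤L (Edge-sym G (subst (λ z → Edge G z (vertex s₁)) x≡₂ (star _ hit₁ (≢-sym x≢₁))))
  ... | no x≢₁ | no x≢₂ = outside-centre gap s₂≤L free (star _ hit₁ (≢-sym x≢₁)) (star _ hit₂ (≢-sym x≢₂))

  escape : ∀ {t} → 0 < t → t < length → vertex t ∉ S →
           (vertex 0 ∉ S × ConnectedIn G S (vertex t) (vertex 0))
           ⊎ (vertex length ∉ S × ConnectedIn G S (vertex t) (vertex length))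
  escape {t} 0<t t<L t∉S with last-below (λ j → vertex j ∈? S) t | first-above (λ j → vertex j ∈? S) t length
  ... | inj₁ below | _ = inj₁ (below 0 0<t , walk-down S P (<⇒≤ t<L) t∉S below)
  ... | inj₂ _ | inj₁ above = inj₂ (above length t<L ≤-refl , walk-up S P (<⇒≤ t<L) ≤-refl above)
  ... | inj₂ (s₁ , s₁<t , hit₁ , below) | inj₂ (s₂ , t<s₂ , s₂≤L , hit₂ , above) =
    ⊥-elim (no-separated-hits (≤-trans (s≤s s₁<t) t<s₂) s₂≤L hit₁ hit₂ free)
    where
      free : FreeBetween s₁ s₂
      free j s₁<j j<s₂ with <-cmp j t
      ... | tri< j<t _ _ = below j s₁<j j<t
      ... | tri≈ _ refl _ = t∉S
      ... | tri> _ _ t<j = above j t<j j<s₂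

-- The regions of bead i are a_i, the inner vertices of B_i, b_i, and the internal vertices of
-- the link from b_i to a_{i+1}. A vertex b_i = a_{i+1} glued by a link of length 0 lies in two.
data Part : Set where
  at-a inner at-b link : Part

data End : Set where
  a-end b-end : End

endPart : End → Part
endPart a-end = at-a
endPart b-end = at-b

module Regions {n} {G : Graph n} (N : Necklace G) where
  open Necklace N

  Internal : (i : Fin m) → Fin (suc (p i)) → Set
  Internal i t = 0 < toℕ t × toℕ t < p i

  BeadPos : (i : Fin m) → Part → Fin (ℓ i) → Set
  BeadPos i at-a  k = k ≡ a i
  BeadPos i inner k = k ≢ a i × k ≢ b i
  BeadPos i at-b  k = k ≡ b i
  BeadPos i link  k = ⊥

  data Occupies (v : Fin n) : Fin m → Part → Set where
    on-bead : ∀ {i κ} k → bead i k ≡ v → BeadPos i κ k → Occupies v i κ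
    on-link : ∀ {i} t → path i t ≡ v → Internal i t → Occupies v i link

  data Coincident : Fin m → Part → Fin m → Part → Set where
    same   : ∀ {i κ} → Coincident i κ i κ
    glued  : ∀ {i i'} → CycSucc i i' → p i ≡ 0 → Coincident i at-b i' at-a
    glued˘ : ∀ {i i'} → CycSucc i i' → p i ≡ 0 → Coincident i' at-a i at-b

  data Step : Fin m → Part → Fin m → Part → Set where
    inner-inner : ∀ {i} → Step i inner i inner
    link-link   : ∀ {i} → Step i link i link
    a-inner     : ∀ {i} → Step i at-a i inner
    inner-b     : ∀ {i} → Step i inner i at-b
    b-link      : ∀ {i} → Step i at-b i link
    link-a      : ∀ {i i'} → CycSucc i i' → Step i link i' at-a
    b-a         : ∀ {i i'} → CycSucc i i' → p i ≡ 1 → Step i at-b i' at-a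

  Adjacent : Fin m → Part → Fin m → Part → Set
  Adjacent i κ j κ' = Step i κ j κ' ⊎ Step j κ' i κ

  data EdgeRegions (u v : Fin n) : Set where
    regions : ∀ {i κ j κ'} → Occupies u i κ → Occupies v j κ' → Adjacent i κ j κ' → EdgeRegions u v

  occupies-a : ∀ i → Occupies (aᵥ i) i at-a
  occupies-a i = on-bead (a i) refl refl

  occupies-b : ∀ i → Occupies (bᵥ i) i at-b
  occupies-b i = on-bead (b i) refl refl

  m≥2-irrefl : ∀ i → ¬ CycSucc i i
  m≥2-irrefl = CycSucc-irrefl m≥2

  beadPos-classify : ∀ i k → Σ[ κ ∈ Part ] BeadPos i κ k
  beadPos-classify i k with k ≟ᶠ a i | k ≟ᶠ b i
  ... | yes k≡a | _ = at-a , k≡a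
  ... | no _ | yes k≡b = at-b , k≡b
  ... | no k≢a | no k≢b = inner , k≢a , k≢b

  beadPos-unique : ∀ {i κ κ' k} → BeadPos i κ k → BeadPos i κ' k → κ ≡ κ'
  beadPos-unique {κ = at-a} {at-a} _ _ = refl
  beadPos-unique {κ = inner} {inner} _ _ = refl
  beadPos-unique {κ = at-b} {at-b} _ _ = refl
  beadPos-unique {i} {at-a} {at-b} refl k≡b = ⊥-elim (a≢b i k≡b)
  beadPos-unique {i} {at-b} {at-a} refl k≡a = ⊥-elim (a≢b i (sym k≡a))
  beadPos-unique {κ = at-a} {inner} refl (k≢a , _) = ⊥-elim (k≢a refl)
  beadPos-unique {κ = inner} {at-a} (k≢a , _) refl = ⊥-elim (k≢a refl)
  beadPos-unique {κ = at-b} {inner} refl (_ , k≢b) = ⊥-elim (k≢b refl)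
  beadPos-unique {κ = inner} {at-b} (_ , k≢b) refl = ⊥-elim (k≢b refl)
  beadPos-unique {κ = link} ()
  beadPos-unique {κ' = link} _ ()

  bead-coincident : ∀ {i j κ κ' k k'} → BeadPos i κ k → BeadPos j κ' k' → bead i k ≡ bead j k' → Coincident i κ j κ'
  bead-coincident {i} {j} {k = k} {k'} pos pos' eq with bead-ident i j k k' eq
  ... | inj₁ (refl , k≡k') rewrite toℕ-injective k≡k' | beadPos-unique pos pos' = same
  ... | inj₂ (inj₁ (i→j , p≡0 , refl , refl))
    with beadPos-unique {κ' = at-b} pos refl | beadPos-unique {κ' = at-a} pos' refl
  ...   | refl | refl = glued i→j p≡0
  bead-coincident pos pos' eq | inj₂ (inj₂ (j→i , p≡0 , refl , refl))
    with beadPos-unique {κ' = at-a} pos refl | beadPos-unique {κ' = at-b} pos' refl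
  ...   | refl | refl = glued˘ j→i p≡0

  occupies-coincident : ∀ {v i κ j κ'} → Occupies v i κ → Occupies v j κ' → Coincident i κ j κ'
  occupies-coincident (on-bead k e pos) (on-bead k' e' pos') = bead-coincident pos pos' (trans e (sym e'))
  occupies-coincident {i = i} {j = j} (on-bead k e _) (on-link t e' (0<t , t<p)) =
    ⊥-elim (internal-new j t 0<t t<p i k (trans e' (sym e)))
  occupies-coincident {i = i} {j = j} (on-link t e (0<t , t<p)) (on-bead k' e' _) =
    ⊥-elim (internal-new i t 0<t t<p j k' (trans e (sym e')))
  occupies-coincident {i = i} {j = j} (on-link t e (0<t , t<p)) (on-link t' e' (0<t' , t'<p))
    with internal-inj i t j t' 0<t t<p 0<t' t'<p (trans e (sym e'))
  ... | refl , _ = same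

  coincident-inner : ∀ {i j} → Coincident i inner j inner → i ≡ j
  coincident-inner same = refl

  ℓ≥2 : ∀ i → 2 ≤ ℓ i
  ℓ≥2 i = ≤-trans (s≤s (s≤s z≤n)) (ℓ≥4 i)

  link-position : ∀ i (t : Fin (suc (p i))) → toℕ t ≡ 0 ⊎ toℕ t ≡ p i ⊎ Internal i t
  link-position i t with toℕ t | toℕ<n t
  ... | zero | _ = inj₁ refl
  ... | suc s | s<p with suc s ≟ p i
  ...   | yes s≡p = inj₂ (inj₁ s≡p)
  ...   | no s≢p = inj₂ (inj₂ (s≤s z≤n , ≤∧≢⇒< (≤-pred s<p) s≢p))

  path-at-start : ∀ i (t : Fin (suc (p i))) → toℕ t ≡ 0 → path i t ≡ bᵥ i
  path-at-start i t t≡0 = trans (cong (path i) (toℕ-injective {j = fzero} t≡0)) (path-start i)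

  path-at-end : ∀ i (t : Fin (suc (p i))) → toℕ t ≡ p i → path i t ≡ aᵥ (csuc i)
  path-at-end i t t≡p =
    trans (cong (path i) (toℕ-injective {j = fromℕ (p i)} (trans t≡p (sym (toℕ-fromℕ (p i))))))
          (path-end i (csuc i) (CycSucc-csuc i))

  occupies-at-start : ∀ {i} {t : Fin (suc (p i))} → toℕ t ≡ 0 → Occupies (path i t) i at-b
  occupies-at-start {i} {t} t≡0 = on-bead (b i) (sym (path-at-start i t t≡0)) refl

  occupies-at-end : ∀ {i} {t : Fin (suc (p i))} → toℕ t ≡ p i → Occupies (path i t) (csuc i) at-a
  occupies-at-end {i} {t} t≡p = on-bead (a (csuc i)) (sym (path-at-end i t t≡p)) refl

  link-occupies : ∀ i t → Occupies (path i t) i at-b ⊎ Occupies (path i t) (csuc i) at-a ⊎ Occupies (path i t) i link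
  link-occupies i t with link-position i t
  ... | inj₁ t≡0 = inj₁ (occupies-at-start t≡0)
  ... | inj₂ (inj₁ t≡p) = inj₂ (inj₁ (occupies-at-end t≡p))
  ... | inj₂ (inj₂ int) = inj₂ (inj₂ (on-link t refl int))

  region-of : ∀ v → Σ[ i ∈ Fin m ] Σ[ κ ∈ Part ] Occupies v i κ
  region-of v with covers v
  ... | inj₁ (i , k , refl) = let κ , pos = beadPos-classify i k in i , κ , on-bead k refl pos
  ... | inj₂ (i , t , refl) with link-occupies i t
  ...   | inj₁ o = i , at-b , o
  ...   | inj₂ (inj₁ o) = csuc i , at-a , o
  ...   | inj₂ (inj₂ o) = i , link , o

  bead-adjacent : ∀ {i κ κ' k k'} → BeadPos i κ k → BeadPos i κ' k' → CycSucc k k' → Adjacent i κ i κ'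
  bead-adjacent {i} {at-a} {at-a} refl refl s = ⊥-elim (CycSucc-irrefl (ℓ≥2 i) _ s)
  bead-adjacent {i} {at-a} {at-b} refl refl s = ⊥-elim (¬succ-ab i s)
  bead-adjacent {i} {at-b} {at-a} refl refl s = ⊥-elim (¬succ-ba i s)
  bead-adjacent {i} {at-b} {at-b} refl refl s = ⊥-elim (CycSucc-irrefl (ℓ≥2 i) _ s)
  bead-adjacent {κ = at-a} {inner} _ _ _ = inj₁ a-inner
  bead-adjacent {κ = inner} {at-a} _ _ _ = inj₂ a-inner
  bead-adjacent {κ = inner} {inner} _ _ _ = inj₁ inner-inner
  bead-adjacent {κ = inner} {at-b} _ _ _ = inj₁ inner-b
  bead-adjacent {κ = at-b} {inner} _ _ _ = inj₂ inner-b
  bead-adjacent {κ = link} ()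
  bead-adjacent {κ' = link} _ ()

  bead-edge-regions : ∀ i k k' → CycSucc k k' → EdgeRegions (bead i k) (bead i k')
  bead-edge-regions i k k' s with beadPos-classify i k | beadPos-classify i k'
  ... | _ , pos | _ , pos' = regions (on-bead k refl pos) (on-bead k' refl pos') (bead-adjacent pos pos' s)

  link-edge-regions : ∀ i (t t' : Fin (suc (p i))) → suc (toℕ t) ≡ toℕ t' → EdgeRegions (path i t) (path i t')
  link-edge-regions i t t' st≡t' with link-position i t | link-position i t'
  ... | _ | inj₁ t'≡0 = ⊥-elim (1+n≢0 (trans st≡t' t'≡0))
  ... | inj₂ (inj₁ t≡p) | _ = ⊥-elim (<⇒≱ (toℕ<n t') (≤-reflexive (trans (cong suc (sym t≡p)) st≡t')))
  ... | inj₁ t≡0 | inj₂ (inj₁ t'≡p) =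
    regions (occupies-at-start t≡0) (occupies-at-end t'≡p)
            (inj₁ (b-a (CycSucc-csuc i) (trans (sym t'≡p) (trans (sym st≡t') (cong suc t≡0)))))
  ... | inj₁ t≡0 | inj₂ (inj₂ int') = regions (occupies-at-start t≡0) (on-link t' refl int') (inj₁ b-link)
  ... | inj₂ (inj₂ int) | inj₂ (inj₁ t'≡p) =
    regions (on-link t refl int) (occupies-at-end t'≡p) (inj₁ (link-a (CycSucc-csuc i)))
  ... | inj₂ (inj₂ int) | inj₂ (inj₂ int') = regions (on-link t refl int) (on-link t' refl int') (inj₁ link-link)

  EdgeRegions-sym : ∀ {u v} → EdgeRegions u v → EdgeRegions v u
  EdgeRegions-sym (regions o o' adj) = regions o' o (swap⊎ adj)

  edge-regions : ∀ {u v} → Edge G u v → EdgeRegions u v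
  edge-regions {u} {v} e with edges-sound u v e
  ... | inj₁ (i , k , k' , s , inj₁ (refl , refl)) = bead-edge-regions i k k' s
  ... | inj₁ (i , k , k' , s , inj₂ (refl , refl)) = EdgeRegions-sym (bead-edge-regions i k k' s)
  ... | inj₂ (i , t , t' , s , inj₁ (refl , refl)) = link-edge-regions i t t' s
  ... | inj₂ (i , t , t' , s , inj₂ (refl , refl)) = EdgeRegions-sym (link-edge-regions i t t' s)

  BeadVertex : Set
  BeadVertex = Σ (Fin m) (Fin ∘ ℓ)

  LinkVertex : Set
  LinkVertex = Σ (Fin m) (λ i → Fin (suc (p i)))

  inner-bead-ident : ∀ {i j k k'} → BeadPos i inner k → bead j k' ≡ bead i k → _≡_ {A = BeadVertex} (j , k') (i , k)
  inner-bead-ident {i} {j} {k} {k'} pos eq with bead-ident j i k' k eq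
  ... | inj₁ (refl , k'≡k) = cong (j ,_) (toℕ-injective k'≡k)
  ... | inj₂ (inj₁ (_ , _ , _ , k≡a)) = ⊥-elim (proj₁ pos k≡a)
  ... | inj₂ (inj₂ (_ , _ , k≡b , _)) = ⊥-elim (proj₂ pos k≡b)

  link-not-inner : ∀ {i k} j t → BeadPos i inner k → path j t ≢ bead i k
  link-not-inner j t pos eq with link-occupies j t
  ... | inj₁ o with occupies-coincident o (on-bead _ (sym eq) pos)
  ...   | ()
  link-not-inner j t pos eq | inj₂ (inj₁ o) with occupies-coincident o (on-bead _ (sym eq) pos)
  ...   | ()
  link-not-inner j t pos eq | inj₂ (inj₂ o) with occupies-coincident o (on-bead _ (sym eq) pos)
  ...   | ()

  inner-neighbour : ∀ {i k v} → BeadPos i inner k → Edge G (bead i k) v →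
                    Σ[ k' ∈ Fin (ℓ i) ] (bead i k' ≡ v × (CycSucc k k' ⊎ CycSucc k' k))
  inner-neighbour {i} {k} {v} pos e with edges-sound (bead i k) v e
  ... | inj₁ (j , k₁ , k₂ , s , inj₁ (e₁ , e₂)) with inner-bead-ident pos e₁
  ...   | refl = k₂ , e₂ , inj₁ s
  inner-neighbour pos e | inj₁ (j , k₁ , k₂ , s , inj₂ (e₁ , e₂)) with inner-bead-ident pos e₂
  ...   | refl = k₁ , e₁ , inj₂ s
  inner-neighbour pos e | inj₂ (j , t , _ , _ , inj₁ (e₁ , _)) = ⊥-elim (link-not-inner j t pos e₁)
  inner-neighbour pos e | inj₂ (j , _ , t' , _ , inj₂ (_ , e₂)) = ⊥-elim (link-not-inner j t' pos e₂)

  internal-unique : ∀ {i j t t'} → Internal i t → path j t' ≡ path i t → _≡_ {A = LinkVertex} (j , t') (i , t)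
  internal-unique {i} {j} {t} {t'} (0<t , t<p) eq with link-position j t'
  ... | inj₁ t'≡0 = ⊥-elim (internal-new i t 0<t t<p j (b j) (trans (sym eq) (path-at-start j t' t'≡0)))
  ... | inj₂ (inj₁ t'≡p) = ⊥-elim (internal-new i t 0<t t<p (csuc j) (a (csuc j)) (trans (sym eq) (path-at-end j t' t'≡p)))
  ... | inj₂ (inj₂ (0<t' , t'<p)) with internal-inj j t' i t 0<t' t'<p 0<t t<p eq
  ...   | refl , t'≡t = cong (j ,_) (toℕ-injective t'≡t)

  link-neighbour : ∀ {i t v} → Internal i t → Edge G (path i t) v →
                   Σ[ t' ∈ Fin (suc (p i)) ] (path i t' ≡ v × (suc (toℕ t) ≡ toℕ t' ⊎ suc (toℕ t') ≡ toℕ t))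
  link-neighbour {i} {t} {v} (0<t , t<p) e with edges-sound (path i t) v e
  ... | inj₁ (j , k , _ , _ , inj₁ (e₁ , _)) = ⊥-elim (internal-new i t 0<t t<p j k (sym e₁))
  ... | inj₁ (j , _ , k' , _ , inj₂ (_ , e₂)) = ⊥-elim (internal-new i t 0<t t<p j k' (sym e₂))
  ... | inj₂ (j , t₁ , t₂ , s , inj₁ (e₁ , e₂)) with internal-unique (0<t , t<p) e₁
  ...   | refl = t₂ , e₂ , inj₁ s
  link-neighbour (0<t , t<p) e | inj₂ (j , t₁ , t₂ , s , inj₂ (e₁ , e₂)) with internal-unique (0<t , t<p) e₂
  ...   | refl = t₁ , e₁ , inj₂ s

  a-b-nonadjacent : ∀ i → ¬ Edge G (aᵥ i) (bᵥ i)
  a-b-nonadjacent i e with edge-regions e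
  ... | regions o o' adj = no-adjacency (occupies-coincident (occupies-a i) o) (occupies-coincident (occupies-b i) o') adj
    where
      no-adjacency : ∀ {j κ j' κ'} → Coincident i at-a j κ → Coincident i at-b j' κ' → ¬ Adjacent j κ j' κ'
      no-adjacency same same (inj₂ (b-a i→i _)) = m≥2-irrefl i i→i
      no-adjacency (glued˘ _ p≡0) (glued _ _) (inj₁ (b-a _ p≡1)) = 0≢1+n (trans (sym p≡0) p≡1)
      no-adjacency same same (inj₁ ())
      no-adjacency same (glued _ _) (inj₁ ())
      no-adjacency (glued˘ _ _) same (inj₂ ())
      no-adjacency (glued˘ _ _) (glued _ _) (inj₂ ())

  cap : ∀ i → ℕ → Fin (suc (p i))
  cap i t = fromℕ< (s≤s (m⊓n≤n t (p i)))

  toℕ-cap : ∀ i {t} → t ≤ p i → toℕ (cap i t) ≡ t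
  toℕ-cap i {t} t≤p = trans (toℕ-fromℕ< _) (m≤n⇒m⊓n≡m t≤p)

  path-injective : ∀ i {t t'} → path i t ≡ path i t' → t ≡ t'
  path-injective i {t} {t'} eq with link-position i t | link-position i t'
  ... | inj₂ (inj₂ int) | _ with internal-unique int (sym eq)
  ...   | refl = refl
  path-injective i eq | _ | inj₂ (inj₂ int') with internal-unique int' eq
  ...   | refl = refl
  path-injective i eq | inj₁ t≡0 | inj₁ t'≡0 = toℕ-injective (trans t≡0 (sym t'≡0))
  path-injective i eq | inj₂ (inj₁ t≡p) | inj₂ (inj₁ t'≡p) = toℕ-injective (trans t≡p (sym t'≡p))
  path-injective i {t} {t'} eq | inj₁ t≡0 | inj₂ (inj₁ t'≡p)
    with occupies-coincident (occupies-at-start t≡0) (subst (λ v → Occupies v (csuc i) at-a) (sym eq) (occupies-at-end t'≡p))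
  ...   | glued _ p≡0 = toℕ-injective (trans t≡0 (trans (sym p≡0) (sym t'≡p)))
  path-injective i {t} {t'} eq | inj₂ (inj₁ t≡p) | inj₁ t'≡0
    with occupies-coincident (occupies-at-start t'≡0) (subst (λ v → Occupies v (csuc i) at-a) eq (occupies-at-end t≡p))
  ...   | glued _ p≡0 = toℕ-injective (trans t≡p (trans p≡0 (sym t'≡0)))

  bead-injective : ∀ i {k k'} → bead i k ≡ bead i k' → k ≡ k'
  bead-injective i {k} {k'} eq with bead-ident i i k k' eq
  ... | inj₁ (_ , k≡k') = toℕ-injective k≡k'
  ... | inj₂ (inj₁ (i→i , _)) = ⊥-elim (m≥2-irrefl i i→i)
  ... | inj₂ (inj₂ (i→i , _)) = ⊥-elim (m≥2-irrefl i i→i)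

  beadArc : ∀ i (c : Fin (ℓ i)) D → D < ℓ i → (∀ {t} → 0 < t → t < D → BeadPos i inner (csuc^ t c)) → BarePath G
  beadArc i c D D<ℓ inner-between = record
    { length = D
    ; vertex = λ t → bead i (csuc^ t c)
    ; edge = λ {t} _ → bead-edge i (csuc^ t c) _ (CycSucc-csuc _)
    ; injective = λ t≤D t'≤D eq → csuc^-injective c (≤-<-trans t≤D D<ℓ) (≤-<-trans t'≤D D<ℓ) (bead-injective i eq)
    ; interior-neighbour = neighbour }
    where
      neighbour : ∀ {t v} → suc t < D → Edge G (bead i (csuc^ (suc t) c)) v →
                  v ≡ bead i (csuc^ t c) ⊎ v ≡ bead i (csuc^ (suc (suc t)) c)
      neighbour st<D e with inner-neighbour (inner-between (s≤s z≤n) st<D) e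
      ... | _ , refl , inj₁ forward = inj₂ (cong (bead i) (CycSucc-functional forward (CycSucc-csuc _)))
      ... | _ , refl , inj₂ backward = inj₁ (cong (bead i) (CycSucc-injective backward (CycSucc-csuc _)))

  linkPath : Fin m → BarePath G
  linkPath i = record
    { length = p i
    ; vertex = λ t → path i (cap i t)
    ; edge = λ {t} t<p →
        path-edge i (cap i t) (cap i (suc t)) (trans (cong suc (toℕ-cap i (<⇒≤ t<p))) (sym (toℕ-cap i t<p)))
    ; injective = λ t≤p t'≤p eq →
        trans (sym (toℕ-cap i t≤p)) (trans (cong toℕ (path-injective i eq)) (toℕ-cap i t'≤p))
    ; interior-neighbour = neighbour }
    where
      neighbour : ∀ {t v} → suc t < p i → Edge G (path i (cap i (suc t))) v →
                  v ≡ path i (cap i t) ⊎ v ≡ path i (cap i (suc (suc t)))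
      neighbour {t} st<p e with link-neighbour (subst (0 <_) (sym (toℕ-cap i (<⇒≤ st<p))) (s≤s z≤n) ,
                                                subst (_< p i) (sym (toℕ-cap i (<⇒≤ st<p))) st<p) e
      ... | t' , refl , inj₁ forward = inj₂ (cong (path i) (toℕ-injective (begin
             toℕ t'                     ≡⟨ forward ⟨
             suc (toℕ (cap i (suc t)))  ≡⟨ cong suc (toℕ-cap i (<⇒≤ st<p)) ⟩
             suc (suc t)                ≡⟨ toℕ-cap i st<p ⟨
             toℕ (cap i (suc (suc t)))  ∎)))
      ... | t' , refl , inj₂ backward = inj₁ (cong (path i) (toℕ-injective (begin
             toℕ t'                     ≡⟨ suc-injective (trans backward (toℕ-cap i (<⇒≤ st<p))) ⟩
             t                          ≡⟨ toℕ-cap i (<⇒≤ (<-trans (n<1+n t) st<p)) ⟨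
             toℕ (cap i t)              ∎)))

  b-alone : ∀ {i j κ} → p i ≢ 0 → Coincident i at-b j κ → _≡_ {A = Fin m × Part} (j , κ) (i , at-b)
  b-alone _ same = refl
  b-alone p≢0 (glued _ p≡0) = ⊥-elim (p≢0 p≡0)

  a-alone : ∀ {i i' j κ} → p i ≢ 0 → CycSucc i i' → Coincident i' at-a j κ →
            _≡_ {A = Fin m × Part} (j , κ) (i' , at-a)
  a-alone _ _ same = refl
  a-alone {i} p≢0 i→i' (glued˘ j→i' p≡0) =
    ⊥-elim (p≢0 (subst (λ j → p j ≡ 0) (CycSucc-injective j→i' i→i') p≡0))

  next-to-b : ∀ {i j κ} → p i ≢ 1 → Adjacent j κ i at-b →
              _≡_ {A = Fin m × Part} (j , κ) (i , inner) ⊎ (j , κ) ≡ (i , link)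
  next-to-b _ (inj₁ inner-b) = inj₁ refl
  next-to-b _ (inj₂ b-link) = inj₂ refl
  next-to-b p≢1 (inj₂ (b-a _ p≡1)) = ⊥-elim (p≢1 p≡1)

  next-to-a : ∀ {i i' j κ} → p i ≢ 1 → CycSucc i i' → Adjacent j κ i' at-a →
              _≡_ {A = Fin m × Part} (j , κ) (i' , inner) ⊎ (j , κ) ≡ (i , link)
  next-to-a _ i→i' (inj₁ (link-a j→i')) = inj₂ (cong (_, link) (CycSucc-injective j→i' i→i'))
  next-to-a p≢1 i→i' (inj₁ (b-a j→i' p≡1)) =
    ⊥-elim (p≢1 (subst (λ j → p j ≡ 1) (CycSucc-injective j→i' i→i') p≡1))
  next-to-a _ _ (inj₂ a-inner) = inj₁ refl

  module _ {i} (2≤p : 2 ≤ p i) where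
    private
      p≢0 : p i ≢ 0
      p≢0 p≡0 = contradiction (subst (2 ≤_) p≡0 2≤p) λ ()
      p≢1 : p i ≢ 1
      p≢1 p≡1 = contradiction (subst (2 ≤_) p≡1 2≤p) λ { (s≤s ()) }

    link-ends-nonadjacent : ¬ Edge G (bᵥ i) (aᵥ (csuc i))
    link-ends-nonadjacent e with edge-regions e
    ... | regions o o' adj
      with b-alone p≢0 (occupies-coincident (occupies-b i) o)
         | a-alone p≢0 (CycSucc-csuc i) (occupies-coincident (occupies-a (csuc i)) o')
    ... | refl | refl with adj
    ...   | inj₁ (b-a _ p≡1) = p≢1 p≡1

    link-ends-common-neighbour : ∀ y → Edge G y (bᵥ i) → Edge G y (aᵥ (csuc i)) → y ≡ path i (cap i 1) × p i ≡ 2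
    link-ends-common-neighbour y e e' with edge-regions e | edge-regions e'
    ... | regions o ob adj | regions o' oa adj'
      with b-alone p≢0 (occupies-coincident (occupies-b i) ob)
         | a-alone p≢0 (CycSucc-csuc i) (occupies-coincident (occupies-a (csuc i)) oa)
    ... | refl | refl with next-to-b p≢1 adj | next-to-a p≢1 (CycSucc-csuc i) adj'
    ...   | inj₁ refl | inj₁ refl =
            ⊥-elim (m≥2-irrefl i (subst (CycSucc i) (sym (coincident-inner (occupies-coincident o o'))) (CycSucc-csuc i)))
    ...   | inj₁ refl | inj₂ refl with occupies-coincident o o'
    ...     | ()
    link-ends-common-neighbour y e e' | regions o _ _ | regions o' _ _ | refl | refl | inj₂ refl | inj₁ refl
      with occupies-coincident o o'
    ...     | ()
    link-ends-common-neighbour y e e' | regions (on-link t refl int) _ _ | _ | refl | refl | inj₂ refl | inj₂ refl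
      with link-neighbour int e | link-neighbour int e'
    ...     | t₀ , t₀≡b , rel₀ | t₁ , t₁≡a , rel₁ =
              cong (path i) (toℕ-injective (trans t≡1 (sym (toℕ-cap i (<⇒≤ 2≤p))))) , p≡2
      where
        t₀≡0 : toℕ t₀ ≡ 0
        t₀≡0 = cong toℕ (path-injective i (trans t₀≡b (sym (path-start i))))
        t₁≡p : toℕ t₁ ≡ p i
        t₁≡p = trans (cong toℕ (path-injective i (trans t₁≡a (sym (path-at-end i (fromℕ (p i)) (toℕ-fromℕ (p i)))))))
                     (toℕ-fromℕ (p i))
        t≡1 : toℕ t ≡ 1
        t≡1 = [ (λ st≡t₀ → ⊥-elim (1+n≢0 (trans st≡t₀ t₀≡0))) ,
                (λ st₀≡t → trans (sym st₀≡t) (cong suc t₀≡0)) ]′ rel₀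
        p≡2 : p i ≡ 2
        p≡2 = [ (λ st≡t₁ → trans (sym t₁≡p) (trans (sym st≡t₁) (cong suc t≡1))) ,
                (λ st₁≡t → ⊥-elim (<⇒≱ (proj₂ int)
                                         (≤-trans (n≤1+n (p i)) (≤-reflexive (trans (cong suc (sym t₁≡p)) st₁≡t))))) ]′ rel₁

  terminal : Fin m → End → Fin n
  terminal j a-end = aᵥ j
  terminal j b-end = bᵥ j

  span : Fin m → ℕ
  span i = proj₁ (csuc^-surjective (a i) (b i))

  span<ℓ : ∀ i → span i < ℓ i
  span<ℓ i = proj₁ (proj₂ (csuc^-surjective (a i) (b i)))

  csuc^-span : ∀ i → csuc^ (span i) (a i) ≡ b i
  csuc^-span i = proj₂ (proj₂ (csuc^-surjective (a i) (b i)))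

  co-span : Fin m → ℕ
  co-span i = ℓ i ∸ span i

  csuc^-co-span : ∀ i → csuc^ (co-span i) (b i) ≡ a i
  csuc^-co-span i = begin
    csuc^ (co-span i) (b i)                  ≡⟨ cong (csuc^ (co-span i)) (csuc^-span i) ⟨
    csuc^ (co-span i) (csuc^ (span i) (a i)) ≡⟨ csuc^-+ (co-span i) (span i) (a i) ⟨
    csuc^ (co-span i + span i) (a i)         ≡⟨ cong (λ t → csuc^ t (a i)) (m∸n+n≡m (<⇒≤ (span<ℓ i))) ⟩
    csuc^ (ℓ i) (a i)                        ≡⟨ csuc^-period (a i) ⟩
    a i                                      ∎

  span≥2 : ∀ i → 2 ≤ span i
  span≥2 i = csuc^-steps≥2 (a≢b i) (¬succ-ab i) (csuc^-span i)

  co-span≥2 : ∀ i → 2 ≤ co-span i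
  co-span≥2 i = csuc^-steps≥2 (a≢b i ∘ sym) (¬succ-ba i) (csuc^-co-span i)

  co-span<ℓ : ∀ i → co-span i < ℓ i
  co-span<ℓ i = ∸-monoʳ-< (≤-trans (s≤s z≤n) (span≥2 i)) (<⇒≤ (span<ℓ i))

  arcAB-inner : ∀ i {t} → 0 < t → t < span i → BeadPos i inner (csuc^ t (a i))
  arcAB-inner i = csuc^-between (csuc^-span i) (span<ℓ i)

  arcBA-inner : ∀ i {t} → 0 < t → t < co-span i → BeadPos i inner (csuc^ t (b i))
  arcBA-inner i 0<t t<D = swap (csuc^-between (csuc^-co-span i) (co-span<ℓ i) 0<t t<D)

  arcAB : Fin m → BarePath G
  arcAB i = beadArc i (a i) (span i) (span<ℓ i) (arcAB-inner i)

  arcBA : Fin m → BarePath G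
  arcBA i = beadArc i (b i) (co-span i) (co-span<ℓ i) (arcBA-inner i)

  arcAB-end : ∀ i → bead i (csuc^ (span i) (a i)) ≡ bᵥ i
  arcAB-end i = cong (bead i) (csuc^-span i)

  arcBA-end : ∀ i → bead i (csuc^ (co-span i) (b i)) ≡ aᵥ i
  arcBA-end i = cong (bead i) (csuc^-co-span i)

  link-start : ∀ i → path i (cap i 0) ≡ bᵥ i
  link-start i = path-at-start i (cap i 0) (toℕ-cap i z≤n)

  link-end : ∀ i → path i (cap i (p i)) ≡ aᵥ (csuc i)
  link-end i = path-at-end i (cap i (p i)) (toℕ-cap i ≤-refl)

  inner-not-terminal : ∀ {i k} j ε → BeadPos i inner k → bead i k ≢ terminal j ε
  inner-not-terminal j a-end pos eq with occupies-coincident (on-bead _ refl pos) (on-bead {κ = at-a} (a j) (sym eq) refl)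
  ... | ()
  inner-not-terminal j b-end pos eq with occupies-coincident (on-bead _ refl pos) (on-bead {κ = at-b} (b j) (sym eq) refl)
  ... | ()

  inner-next-bead : ∀ {i k k'} → BeadPos i inner k → BeadPos (csuc i) inner k' → bead i k ≢ bead (csuc i) k'
  inner-next-bead {i} pos pos' eq =
    m≥2-irrefl i (subst (CycSucc i) (sym (coincident-inner (bead-coincident pos pos' eq))) (CycSucc-csuc i))

-- Every free vertex reaches a free terminal

module _ {n} {G : Graph n} (N : Necklace G) {S : Subset n} {x : Fin n} (x∈S : x ∈ S)
         (star : ∀ y → y ∈ S → y ≢ x → Edge G x y) (no-short : ¬ HasShortBead N) where
  open Necklace N
  open Regions N

  ReachesTerminal : Fin n → Set
  ReachesTerminal u = Σ[ j ∈ Fin m ] Σ[ ε ∈ End ] (terminal j ε ∉ S × ConnectedIn G S u (terminal j ε))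

  private
    reach-along : (P : BarePath G) → EndsNonadjacent P → OnlyMiddleCommonNeighbour P →
      ∀ {j ε j' ε'} → BarePath.vertex P 0 ≡ terminal j ε → BarePath.vertex P (BarePath.length P) ≡ terminal j' ε' →
      ∀ {t u} → 0 < t → t < BarePath.length P → BarePath.vertex P t ≡ u → u ∉ S → ReachesTerminal u
    reach-along P nonadjacent common {j} {ε} {j'} {ε'} start end 0<t t<L refl u∉S
      with escape x∈S star P nonadjacent common 0<t t<L u∉S
    ... | inj₁ (0∉S , c) = j , ε , subst (_∉ S) start 0∉S , subst (ConnectedIn G S _) start c
    ... | inj₂ (L∉S , c) = j' , ε' , subst (_∉ S) end L∉S , subst (ConnectedIn G S _) end c

  reach-on-arcAB : ∀ i {t u} → 0 < t → t < span i → bead i (csuc^ t (a i)) ≡ u → u ∉ S → ReachesTerminal u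
  reach-on-arcAB i = reach-along (arcAB i)
    (λ _ e → a-b-nonadjacent i (subst (Edge G (aᵥ i)) (arcAB-end i) e))
    (λ _ y e₀ e₁ → ⊥-elim (no-short (i , y , Edge-sym G e₀ , subst (Edge G y) (arcAB-end i) e₁)))
    {ε = a-end} {ε' = b-end} refl (arcAB-end i)

  reach-on-arcBA : ∀ i {t u} → 0 < t → t < co-span i → bead i (csuc^ t (b i)) ≡ u → u ∉ S → ReachesTerminal u
  reach-on-arcBA i = reach-along (arcBA i)
    (λ _ e → a-b-nonadjacent i (Edge-sym G (subst (Edge G (bᵥ i)) (arcBA-end i) e)))
    (λ _ y e₀ e₁ → ⊥-elim (no-short (i , y , Edge-sym G (subst (Edge G y) (arcBA-end i) e₁) , e₀)))
    {ε = b-end} {ε' = a-end} refl (arcBA-end i)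

  reach-on-link : ∀ i {t u} → Internal i t → path i t ≡ u → u ∉ S → ReachesTerminal u
  reach-on-link i {t} (0<t , t<p) refl = reach-along (linkPath i)
    (λ 2≤p e → link-ends-nonadjacent 2≤p (subst₂ (Edge G) (link-start i) (link-end i) e))
    (λ 2≤p y e₀ e₁ → link-ends-common-neighbour 2≤p y (subst (Edge G y) (link-start i) e₀)
                                                       (subst (Edge G y) (link-end i) e₁))
    {ε = b-end} {ε' = a-end} (link-start i) (link-end i) 0<t t<p
    (cong (path i) (toℕ-injective (toℕ-cap i (<⇒≤ t<p))))

  reach-terminal : ∀ u → u ∉ S → ReachesTerminal u
  reach-terminal u u∉S with region-of u
  ... | i , at-a , on-bead _ refl refl = i , a-end , u∉S , here
  ... | i , at-b , on-bead _ refl refl = i , b-end , u∉S , here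
  ... | i , link , on-link t e int = reach-on-link i int e u∉S
  ... | i , inner , on-bead k refl (k≢a , k≢b) with csuc^-surjective (a i) k
  ...   | t , t<ℓ , refl with <-cmp t (span i)
  ...     | tri< t<span _ _ = reach-on-arcAB i (n≢0⇒n>0 λ { refl → k≢a refl }) t<span refl u∉S
  ...     | tri≈ _ refl _ = contradiction (csuc^-span i) k≢b
  ...     | tri> _ _ span<t = reach-on-arcBA i (m<n⇒0<n∸m span<t) (∸-monoˡ-< t<ℓ (<⇒≤ span<t)) (cong (bead i) (begin
              csuc^ (t ∸ span i) (b i)                    ≡⟨ cong (csuc^ (t ∸ span i)) (csuc^-span i) ⟨
              csuc^ (t ∸ span i) (csuc^ (span i) (a i))   ≡⟨ csuc^-+ (t ∸ span i) (span i) (a i) ⟨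
              csuc^ (t ∸ span i + span i) (a i)           ≡⟨ cong (λ s → csuc^ s (a i)) (m∸n+n≡m (<⇒≤ span<t)) ⟩
              csuc^ t (a i)                               ∎)) u∉S

-- Heights in the cyclic cover

rank : Part → ℕ
rank at-a = 0
rank inner = 1
rank at-b = 2
rank link = 3

rank<4 : ∀ κ → rank κ < 4
rank<4 at-a = s≤s z≤n
rank<4 inner = s≤s (s≤s z≤n)
rank<4 at-b = s≤s (s≤s (s≤s z≤n))
rank<4 link = s≤s (s≤s (s≤s (s≤s z≤n)))

private
  unrank : ℕ → Part
  unrank 0 = at-a
  unrank 1 = inner
  unrank 2 = at-b
  unrank _ = link

  unrank-rank : ∀ κ → unrank (rank κ) ≡ κ
  unrank-rank at-a = refl
  unrank-rank inner = refl
  unrank-rank at-b = refl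
  unrank-rank link = refl

rank-injective : ∀ {κ κ'} → rank κ ≡ rank κ' → κ ≡ κ'
rank-injective {κ} {κ'} eq = trans (sym (unrank-rank κ)) (trans (cong unrank eq) (unrank-rank κ'))

endPart-injective : ∀ {ε ε'} → endPart ε ≡ endPart ε' → ε ≡ ε'
endPart-injective {a-end} {a-end} _ = refl
endPart-injective {b-end} {b-end} _ = refl

-- Heights number the regions of the infinite cyclic cover of the necklace; w counts windings.
module Heights {n} {G : Graph n} (N : Necklace G) where
  open Necklace N
  open Regions N

  period : ℕ
  period = m * 4

  base : ℕ → Fin m → ℕ
  base w i = w * period + toℕ i * 4

  height : ℕ → Fin m → Part → ℕ
  height w i κ = rank κ + base w i

  private
    column<period : ∀ (i : Fin m) κ → toℕ i * 4 + rank κ < period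
    column<period i κ = <-≤-trans (+-monoʳ-< (toℕ i * 4) (rank<4 κ))
                          (≤-trans (≤-reflexive (+-comm (toℕ i * 4) 4)) (*-monoˡ-≤ 4 (toℕ<n i)))

    rearrange : ∀ r w P c → r + (w * P + c) ≡ w * P + (c + r)
    rearrange = solve-∀

  height-injective : ∀ {w i κ w' i' κ'} → height w i κ ≡ height w' i' κ' → w ≡ w' × i ≡ i' × κ ≡ κ'
  height-injective {w} {i} {κ} {w'} {i'} {κ'} eq
    with *+-unique period {w} {w'} (column<period i κ) (column<period i' κ')
           (trans (sym (rearrange (rank κ) w period (toℕ i * 4))) (trans eq (rearrange (rank κ') w' period (toℕ i' * 4))))
  ... | w≡w' , column≡ with *+-unique 4 {toℕ i} {toℕ i'} (rank<4 κ) (rank<4 κ') column≡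
  ...   | i≡i' , rank≡ = w≡w' , toℕ-injective i≡i' , rank-injective rank≡

  height-window : ∀ P {w w' i κ} → P < height w i κ → height w i κ < P + period →
                  P < height w' i κ → height w' i κ < P + period → w ≡ w'
  height-window P {w} {w'} {i} {κ} lo hi lo' hi' =
    *+-window period P (subst (P <_) (eq w) lo) (subst (_< P + period) (eq w) hi)
                       (subst (P <_) (eq w') lo') (subst (_< P + period) (eq w') hi')
    where
      eq : ∀ w → height w i κ ≡ w * period + (toℕ i * 4 + rank κ)
      eq w = rearrange (rank κ) w period (toℕ i * 4)

  height-suc : ∀ w i κ → height (suc w) i κ ≡ height w i κ + period
  height-suc w i κ = shift (rank κ) w period (toℕ i * 4)
    where
      shift : ∀ r w P c → r + (P + w * P + c) ≡ r + (w * P + c) + P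
      shift = solve-∀

  height<period : ∀ w i κ → height w i κ < suc w * period
  height<period w i κ = subst (_< suc w * period) (sym (rearrange (rank κ) w period (toℕ i * 4)))
    (<-≤-trans (+-monoʳ-< (w * period) (column<period i κ)) (≤-reflexive (+-comm (w * period) period)))

  period≤height : ∀ w i κ → w * period ≤ height w i κ
  period≤height w i κ = ≤-trans (m≤m+n (w * period) (toℕ i * 4)) (m≤n+m _ (rank κ))

  terminal-even : ∀ w j ε → Even (height w j (endPart ε))
  terminal-even w j a-end = w * (m * 2) + toℕ j * 2 , double w m (toℕ j)
    where
      double : ∀ w m j → w * (m * 4) + j * 4 ≡ (w * (m * 2) + j * 2) + (w * (m * 2) + j * 2)
      double = solve-∀
  terminal-even w j b-end = suc (w * (m * 2) + toℕ j * 2) , double w m (toℕ j)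
    where
      double : ∀ w m j → 2 + (w * (m * 4) + j * 4) ≡ suc (w * (m * 2) + j * 2) + suc (w * (m * 2) + j * 2)
      double = solve-∀

  private
    base-step : ∀ {i i' : Fin m} → suc (toℕ i) ≡ toℕ i' → ∀ w → base w i' ≡ 4 + base w i
    base-step {i} {i'} e w = trans (cong (λ z → w * period + z * 4) (sym e)) (shift (w * period) (toℕ i * 4))
      where
        shift : ∀ x y → x + (4 + y) ≡ 4 + (x + y)
        shift = solve-∀

    base-wrap : ∀ {i i' : Fin m} → suc (toℕ i) ≡ m → toℕ i' ≡ 0 → ∀ w → base (suc w) i' ≡ 4 + base w i
    base-wrap {i} {i'} e₁ e₂ w = begin
      suc w * period + toℕ i' * 4 ≡⟨ cong (λ z → suc w * period + z * 4) e₂ ⟩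
      suc w * period + 0          ≡⟨ +-identityʳ _ ⟩
      m * 4 + w * period          ≡⟨ cong (λ z → z * 4 + w * period) e₁ ⟨
      suc (toℕ i) * 4 + w * period ≡⟨ shift (w * period) (toℕ i * 4) ⟩
      4 + base w i                ∎
      where
        shift : ∀ x y → 4 + y + x ≡ 4 + (x + y)
        shift = solve-∀

  next-base : ∀ {i i'} → CycSucc i i' → ∀ w → Σ[ w' ∈ ℕ ] base w' i' ≡ 4 + base w i
  next-base (inj₁ e) w = w , base-step e w
  next-base (inj₂ (e₁ , e₂)) w = suc w , base-wrap e₁ e₂ w

  -- Heights are natural numbers, so stepping back across the seam needs winding w' ≥ 1.
  prev-base : ∀ {i i'} → CycSucc i i' → ∀ w' → period ≤ base w' i' → Σ[ w ∈ ℕ ] base w' i' ≡ 4 + base w i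
  prev-base (inj₁ e) w' _ = w' , base-step e w'
  prev-base {i' = i'} (inj₂ (_ , e₂)) zero period≤ =
    contradiction (subst (period ≤_) (cong (_* 4) e₂) period≤) (<⇒≱ (≤-trans (s≤s z≤n) (*-monoˡ-≤ 4 m≥2)))
  prev-base (inj₂ (e₁ , e₂)) (suc w) _ = w , base-wrap e₁ e₂ w

  data Coord (v : Fin n) (e : ℕ) : Set where
    coord : ∀ w {i κ} → Occupies v i κ → e ≡ height w i κ → Coord v e

  coord-terminal : ∀ {v w j ε} → Coord v (height w j (endPart ε)) → v ≡ terminal j ε
  coord-terminal {w = w} {j} {ε} (coord w' {i'} {κ'} o eq) with height-injective {w} {j} {endPart ε} {w'} {i'} {κ'} eq
  ... | _ , refl , κ≡ = at-end ε κ≡ o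
    where
      at-end : ∀ {v j κ} ε → endPart ε ≡ κ → Occupies v j κ → v ≡ terminal j ε
      at-end a-end refl (on-bead _ e refl) = sym e
      at-end b-end refl (on-bead _ e refl) = sym e

  coincident-near : ∀ {i κ j κ'} → Coincident i κ j κ' → ∀ w → period ≤ height w i κ →
                    Σ[ w' ∈ ℕ ] Near (height w i κ) (height w' j κ')
  coincident-near same w _ = w , stay
  coincident-near {i} (glued i→i' _) w _ with next-base i→i' w
  ... | w' , eq = w' , subst (Near _) (sym eq) (jump-up (terminal-even w i b-end))
  coincident-near {i} {j = j} (glued˘ i→i' _) w period≤ with prev-base i→i' w period≤
  ... | w₀ , eq = w₀ , subst (λ e → Near e (height w₀ j at-b)) (sym eq) (jump-down (subst Even eq (terminal-even w i a-end)))

  step-near : ∀ {i κ j κ'} → Step i κ j κ' → ∀ w → Σ[ w' ∈ ℕ ] Near (height w i κ) (height w' j κ')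
  step-near inner-inner w = w , stay
  step-near link-link w = w , stay
  step-near a-inner w = w , up
  step-near inner-b w = w , up
  step-near b-link w = w , up
  step-near (link-a i→i') w with next-base i→i' w
  ... | w' , eq = w' , subst (Near _) (sym eq) up
  step-near {i} (b-a i→i' _) w with next-base i→i' w
  ... | w' , eq = w' , subst (Near _) (sym eq) (jump-up (terminal-even w i b-end))

  step-near˘ : ∀ {i κ j κ'} → Step i κ j κ' → ∀ w' → period ≤ height w' j κ' →
               Σ[ w ∈ ℕ ] Near (height w' j κ') (height w i κ)
  step-near˘ inner-inner w' _ = w' , stay
  step-near˘ link-link w' _ = w' , stay
  step-near˘ a-inner w' _ = w' , down
  step-near˘ inner-b w' _ = w' , down
  step-near˘ b-link w' _ = w' , down
  step-near˘ {i} (link-a i→i') w' period≤ with prev-base i→i' w' period≤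
  ... | w , eq = w , subst (λ e → Near e (height w i link)) (sym eq) down
  step-near˘ {i} {j = j} (b-a i→i' _) w' period≤ with prev-base i→i' w' period≤
  ... | w , eq = w , subst (λ e → Near e (height w i at-b)) (sym eq) (jump-down (subst Even eq (terminal-even w' j a-end)))

  adjacent-near : ∀ {i κ j κ'} → Adjacent i κ j κ' → ∀ w → period ≤ height w i κ →
                  Σ[ w' ∈ ℕ ] Near (height w i κ) (height w' j κ')
  adjacent-near (inj₁ s) w _ = step-near s w
  adjacent-near (inj₂ s) w period≤ = step-near˘ s w period≤

-- Free terminals are connected

module Around {n} {G : Graph n} (N : Necklace G) {S : Subset n} {x : Fin n} (x∈S : x ∈ S)
              (star : ∀ y → y ∈ S → y ≢ x → Edge G x y) where
  open Necklace N
  open Regions N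
  open Heights N

  -- With free vertices at heights P < Q, the star S, connected through x, cannot cross P or Q:
  -- once one of its vertices lies strictly between them, all of them do.
  module Separation {P Q : ℕ} (evP : Even P) (evQ : Even Q) (period≤P : period ≤ P)
                    (P-free : ∀ {v} → Coord v P → v ∉ S) (Q-free : ∀ {v} → Coord v Q → v ∉ S) where

    stay-inside : ∀ {v e e'} → v ∈ S → Coord v e' → P < e → e < Q → Near e e' → P < e' × e' < Q
    stay-inside v∈S c P<e e<Q near with Near-within evP evQ P<e e<Q near
    ... | inj₁ inside = inside
    ... | inj₂ (inj₁ refl) = ⊥-elim (P-free c v∈S)
    ... | inj₂ (inj₂ refl) = ⊥-elim (Q-free c v∈S)

    Inside : Fin n → Set
    Inside v = Σ[ e ∈ ℕ ] (P < e × e < Q × Coord v e)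

    inside-edge : ∀ {u v} → u ∈ S → v ∈ S → Edge G u v → Inside u → Inside v
    inside-edge u∈S v∈S uv (e , P<e , e<Q , coord w o refl) with edge-regions uv
    ... | regions o₁ o₂ adj with coincident-near (occupies-coincident o o₁) w (≤-trans period≤P (<⇒≤ P<e))
    ... | w₁ , near₁ with stay-inside u∈S (coord w₁ o₁ refl) P<e e<Q near₁
    ... | P<e₁ , e₁<Q with adjacent-near adj w₁ (≤-trans period≤P (<⇒≤ P<e₁))
    ... | w₂ , near₂ with stay-inside v∈S (coord w₂ o₂ refl) P<e₁ e₁<Q near₂
    ... | P<e₂ , e₂<Q = _ , P<e₂ , e₂<Q , coord w₂ o₂ refl

    inside-star : ∀ {s s'} → s ∈ S → s' ∈ S → Inside s → Inside s'
    inside-star {s} {s'} s∈S s'∈S s-inside = via-centre s'∈S (via-centre⁻ s∈S s-inside)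
      where
        via-centre⁻ : ∀ {y} → y ∈ S → Inside y → Inside x
        via-centre⁻ {y} y∈S y-inside with y ≟ᶠ x
        ... | yes refl = y-inside
        ... | no y≢x = inside-edge y∈S x∈S (Edge-sym G (star y y∈S y≢x)) y-inside
        via-centre : ∀ {y} → y ∈ S → Inside x → Inside y
        via-centre {y} y∈S x-inside with y ≟ᶠ x
        ... | yes refl = x-inside
        ... | no y≢x = inside-edge x∈S y∈S (star y y∈S y≢x) x-inside

    -- Two heights of the same region differ by a multiple of period.
    no-coord-beyond : ∀ {s s' e'} → s ∈ S → s' ∈ S → Inside s → Q < e' → e' < P + period → ¬ Coord s' e'
    no-coord-beyond s∈S s'∈S s-inside Q<e' e'<P+ (coord w' {i'} {κ'} o' refl) with inside-star s∈S s'∈S s-inside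
    ... | e₁ , P<e₁ , e₁<Q , coord w₁ o₁ refl
      with coincident-near (occupies-coincident o₁ o') w₁ (≤-trans period≤P (<⇒≤ P<e₁))
    ... | w₁' , near with stay-inside s'∈S (coord w₁' o' refl) P<e₁ e₁<Q near
    ... | P<e₁' , e₁'<Q
      with height-window P {w₁'} {w'} {i'} {κ'} P<e₁' (<-trans e₁'<Q (<-trans Q<e' e'<P+))
                                                 (<-trans (<-trans P<e₁' e₁'<Q) Q<e') e'<P+
    ... | refl = <-irrefl refl (<-trans e₁'<Q Q<e')

  LiftedTerminal : Set
  LiftedTerminal = ℕ × Fin m × End

  heightOf : LiftedTerminal → ℕ
  heightOf (w , j , ε) = height w j (endPart ε)

  vertexOf : LiftedTerminal → Fin n
  vertexOf (_ , j , ε) = terminal j ε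

  coordOf : ∀ c → Coord (vertexOf c) (heightOf c)
  coordOf (w , j , a-end) = coord w (occupies-a j) refl
  coordOf (w , j , b-end) = coord w (occupies-b j) refl

  next : LiftedTerminal → LiftedTerminal
  next (w , j , a-end) = w , j , b-end
  next (w , j , b-end) = proj₁ (next-base (CycSucc-csuc j) w) , csuc j , a-end

  next-height : ∀ c → heightOf (next c) ≡ 2 + heightOf c
  next-height (w , j , a-end) = refl
  next-height (w , j , b-end) = proj₂ (next-base (CycSucc-csuc j) w)

  next^ : ℕ → LiftedTerminal → LiftedTerminal
  next^ zero c = c
  next^ (suc k) c = next (next^ k c)

  next^-height : ∀ k c → heightOf (next^ k c) ≡ k + k + heightOf c
  next^-height zero c = refl
  next^-height (suc k) c = trans (next-height (next^ k c)) (trans (cong (2 +_) (next^-height k c)) (two-more k (heightOf c)))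
    where
      two-more : ∀ k h → 2 + (k + k + h) ≡ suc k + suc k + h
      two-more = solve-∀

  next^-increasing : ∀ k c → heightOf c < heightOf (next^ (suc k) c)
  next^-increasing k c = subst (heightOf c <_) (sym (next^-height (suc k) c)) (m<n+m (heightOf c) {suc k + suc k} (s≤s z≤n))

  Blocked : ℕ → ℕ → Set
  Blocked lo hi = Σ[ s ∈ Fin n ] (s ∈ S × Σ[ e ∈ ℕ ] (lo < e × e < hi × Coord s e))

  Blocked-widen : ∀ {lo lo' hi hi'} → lo' ≤ lo → hi ≤ hi' → Blocked lo hi → Blocked lo' hi'
  Blocked-widen lo'≤lo hi≤hi' (s , s∈S , e , lo<e , e<hi , c) =
    s , s∈S , e , ≤-<-trans lo'≤lo lo<e , <-≤-trans e<hi hi≤hi' , c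

  advance : ∀ c → vertexOf c ∉ S → vertexOf (next c) ∉ S →
            ConnectedIn G S (vertexOf c) (vertexOf (next c)) ⊎ Blocked (heightOf c) (heightOf (next c))
  advance (w , j , a-end) a∉S b∉S with traverse-or-meet S (arcAB j) (subst (_∉ S) (sym (arcAB-end j)) b∉S)
  ... | inj₁ conn = inj₁ (subst (ConnectedIn G S _) (arcAB-end j) conn)
  ... | inj₂ (t , 0<t , t<span , t∈S) with traverse-or-meet S (arcBA j) (subst (_∉ S) (sym (arcBA-end j)) a∉S)
  ...   | inj₁ conn = inj₁ (connected-sym b∉S (subst (ConnectedIn G S _) (arcBA-end j) conn))
  ...   | inj₂ _ = inj₂ (bead j (csuc^ t (a j)) , t∈S , height w j inner , ≤-refl , ≤-refl ,
                         coord w (on-bead _ refl (arcAB-inner j 0<t t<span)) refl)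
  advance (w , j , b-end) _ a∉S with traverse-or-meet S (linkPath j) (subst (_∉ S) (sym (link-end j)) a∉S)
  ... | inj₁ conn = inj₁ (subst₂ (ConnectedIn G S) (link-start j) (link-end j) conn)
  ... | inj₂ (t , 0<t , t<p , t∈S) =
        inj₂ (path j (cap j t) , t∈S , height w j link , ≤-refl , ≤-reflexive (sym (proj₂ (next-base (CycSucc-csuc j) w))) ,
              coord w (on-link (cap j t) refl (subst (0 <_) (sym toℕ-t) 0<t , subst (_< p j) (sym toℕ-t) t<p)) refl)
    where toℕ-t = toℕ-cap j (<⇒≤ t<p)

  advance-many : ∀ D c → vertexOf c ∉ S → vertexOf (next^ (suc D) c) ∉ S →
                 ConnectedIn G S (vertexOf c) (vertexOf (next^ (suc D) c)) ⊎ Blocked (heightOf c) (heightOf (next^ (suc D) c))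
  advance-many zero c c∉S end∉S = advance c c∉S end∉S
  advance-many (suc D) c c∉S end∉S with vertexOf (next^ (suc D) c) ∈? S
  ... | yes mid∈S =
        inj₂ (_ , mid∈S , _ , next^-increasing D c , next^-increasing 0 (next^ (suc D) c) , coordOf (next^ (suc D) c))
  ... | no mid∉S with advance-many D c c∉S mid∉S | advance (next^ (suc D) c) mid∉S end∉S
  ...   | inj₁ conn₁ | inj₁ conn₂ = inj₁ (connected-trans conn₁ conn₂)
  ...   | inj₁ _ | inj₂ blocked = inj₂ (Blocked-widen (<⇒≤ (next^-increasing D c)) ≤-refl blocked)
  ...   | inj₂ blocked | _ = inj₂ (Blocked-widen ≤-refl (<⇒≤ (next^-increasing 0 (next^ (suc D) c))) blocked)

  arrive : ∀ D c c' → suc D + suc D + heightOf c ≡ heightOf c' →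
           heightOf (next^ (suc D) c) ≡ heightOf c' × vertexOf (next^ (suc D) c) ≡ vertexOf c'
  arrive D c (w' , j' , ε') eq = reached , coord-terminal {w = w'} {j'} {ε'} (subst (Coord _) reached (coordOf (next^ (suc D) c)))
    where
      reached : heightOf (next^ (suc D) c) ≡ height w' j' (endPart ε')
      reached = trans (next^-height (suc D) c) eq

  not-both-blocked : ∀ j₁ ε₁ j₂ ε₂ → terminal j₁ ε₁ ∉ S → terminal j₂ ε₂ ∉ S →
                     Blocked (height 2 j₁ (endPart ε₁)) (height 2 j₂ (endPart ε₂)) →
                     ¬ Blocked (height 2 j₂ (endPart ε₂)) (height 3 j₁ (endPart ε₁))
  not-both-blocked j₁ ε₁ j₂ ε₂ ∉₁ ∉₂ (s , s∈S , e , P<e , e<Q , c) (s' , s'∈S , e' , Q<e' , e'<P′ , c') =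
    no-coord-beyond s∈S s'∈S (e , P<e , e<Q , c) Q<e' (subst (e' <_) (height-suc 2 j₁ (endPart ε₁)) e'<P′) c'
    where
      open Separation (terminal-even 2 j₁ ε₁) (terminal-even 2 j₂ ε₂)
                      (≤-trans (m≤m+n period _) (period≤height 2 j₁ (endPart ε₁)))
                      (λ c → subst (_∉ S) (sym (coord-terminal {w = 2} {j₁} {ε₁} c)) ∉₁)
                      (λ c → subst (_∉ S) (sym (coord-terminal {w = 2} {j₂} {ε₂} c)) ∉₂)

  -- The terminals are placed in winding 2 so that all heights involved are at least period,
  -- as Separation requires.
  around : ∀ j₁ ε₁ j₂ ε₂ → terminal j₁ ε₁ ∉ S → terminal j₂ ε₂ ∉ S →
           height 2 j₁ (endPart ε₁) < height 2 j₂ (endPart ε₂) → ConnectedIn G S (terminal j₁ ε₁) (terminal j₂ ε₂)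
  around j₁ ε₁ j₂ ε₂ ∉₁ ∉₂ P<Q
    with even-split (terminal-even 2 j₁ ε₁) (terminal-even 2 j₂ ε₂) P<Q
       | even-split (terminal-even 2 j₂ ε₂) (terminal-even 3 j₁ ε₁)
                    (<-≤-trans (height<period 2 j₂ (endPart ε₂)) (period≤height 3 j₁ (endPart ε₁)))
  ... | D₁ , eq₁ | D₂ , eq₂
    with arrive D₁ (2 , j₁ , ε₁) (2 , j₂ , ε₂) eq₁ | arrive D₂ (2 , j₂ , ε₂) (3 , j₁ , ε₁) eq₂
  ... | h₁ , v₁ | h₂ , v₂
    with advance-many D₁ (2 , j₁ , ε₁) ∉₁ (subst (_∉ S) (sym v₁) ∉₂)
       | advance-many D₂ (2 , j₂ , ε₂) ∉₂ (subst (_∉ S) (sym v₂) ∉₁)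
  ... | inj₁ conn | _ = subst (ConnectedIn G S _) v₁ conn
  ... | inj₂ _ | inj₁ conn = connected-sym ∉₂ (subst (ConnectedIn G S _) v₂ conn)
  ... | inj₂ blocked₁ | inj₂ blocked₂ =
        ⊥-elim (not-both-blocked j₁ ε₁ j₂ ε₂ ∉₁ ∉₂ (Blocked-widen ≤-refl (≤-reflexive h₁) blocked₁)
                                                  (Blocked-widen ≤-refl (≤-reflexive h₂) blocked₂))

  terminals-connected : ∀ j₁ ε₁ j₂ ε₂ → terminal j₁ ε₁ ∉ S → terminal j₂ ε₂ ∉ S →
                        ConnectedIn G S (terminal j₁ ε₁) (terminal j₂ ε₂)
  terminals-connected j₁ ε₁ j₂ ε₂ ∉₁ ∉₂ with <-cmp (height 2 j₁ (endPart ε₁)) (height 2 j₂ (endPart ε₂))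
  ... | tri< P<Q _ _ = around j₁ ε₁ j₂ ε₂ ∉₁ ∉₂ P<Q
  ... | tri> _ _ Q<P = connected-sym ∉₂ (around j₂ ε₂ j₁ ε₁ ∉₂ ∉₁ Q<P)
  ... | tri≈ _ P≡Q _ with height-injective {2} {j₁} {endPart ε₁} {2} {j₂} {endPart ε₂} P≡Q
  ...   | _ , refl , κ≡ with endPart-injective κ≡
  ...     | refl = here

short-bead? : ∀ {n} {G : Graph n} (N : Necklace G) → Dec (HasShortBead N)
short-bead? {G = G} N = any? λ i → any? λ w → (Graph.adj G (aᵥ i) w ≟ᵇ true) ×-dec (Graph.adj G w (bᵥ i) ≟ᵇ true)
  where open Necklace N

star-cutset⇒short-bead : ∀ {n} {G : Graph n} (N : Necklace G) → HasStarCutset G → HasShortBead N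
star-cutset⇒short-bead {G = G} N (S , (u , v , u∉S , v∉S , u≁v) , x , x∈S , star) with short-bead? N
... | yes short = short
... | no no-short with reach-terminal N x∈S star no-short u u∉S | reach-terminal N x∈S star no-short v v∉S
...   | j₁ , ε₁ , ∉₁ , u~T₁ | j₂ , ε₂ , ∉₂ , v~T₂ =
  contradiction u~v u≁v
  where
    open Around N x∈S star
    u~v : ConnectedIn G S u v
    u~v = connected-trans u~T₁ (connected-trans (terminals-connected j₁ ε₁ j₂ ε₂ ∉₁ ∉₂) (connected-sym v∉S v~T₂))

module ShortBead {n} {G : Graph n} (N : Necklace G) (i : Fin (Necklace.m N)) {w : Fin n}
                 (a~w : Edge G (Necklace.aᵥ N i) w) (w~b : Edge G w (Necklace.bᵥ N i)) where
  open Necklace N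
  open Regions N

  S : Subset n
  S = ⁅ w ⁆ ∪ (⁅ aᵥ i ⁆ ∪ ⁅ bᵥ i ⁆)

  ∈S⁻ : ∀ {y} → y ∈ S → y ≡ w ⊎ y ≡ aᵥ i ⊎ y ≡ bᵥ i
  ∈S⁻ y∈S with x∈p∪q⁻ ⁅ w ⁆ _ y∈S
  ... | inj₁ y∈w = inj₁ (x∈⁅y⁆⇒x≡y w y∈w)
  ... | inj₂ y∈ab with x∈p∪q⁻ ⁅ aᵥ i ⁆ ⁅ bᵥ i ⁆ y∈ab
  ...   | inj₁ y∈a = inj₂ (inj₁ (x∈⁅y⁆⇒x≡y _ y∈a))
  ...   | inj₂ y∈b = inj₂ (inj₂ (x∈⁅y⁆⇒x≡y _ y∈b))

  w∈S : w ∈ S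
  w∈S = p⊆p∪q _ (x∈⁅x⁆ w)

  a∈S : aᵥ i ∈ S
  a∈S = q⊆p∪q ⁅ w ⁆ _ (p⊆p∪q _ (x∈⁅x⁆ (aᵥ i)))

  b∈S : bᵥ i ∈ S
  b∈S = q⊆p∪q ⁅ w ⁆ _ (q⊆p∪q ⁅ aᵥ i ⁆ _ (x∈⁅x⁆ (bᵥ i)))

  w-centre : ∀ y → y ∈ S → y ≢ w → Edge G w y
  w-centre y y∈S y≢w with ∈S⁻ y∈S
  ... | inj₁ y≡w = contradiction y≡w y≢w
  ... | inj₂ (inj₁ refl) = Edge-sym G a~w
  ... | inj₂ (inj₂ refl) = w~b

  inner-∉S : ∀ {j k} → BeadPos j inner k → bead j k ≢ w → bead j k ∉ S
  inner-∉S pos ≢w y∈S with ∈S⁻ y∈S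
  ... | inj₁ eq = ≢w eq
  ... | inj₂ (inj₁ eq) = inner-not-terminal i a-end pos eq
  ... | inj₂ (inj₂ eq) = inner-not-terminal i b-end pos eq

  u₁ u₂ v : Fin n
  u₁ = bead i (csuc^ 1 (a i))
  u₂ = bead i (csuc^ 1 (b i))
  v = bead (csuc i) (csuc^ 1 (a (csuc i)))

  u₁-inner : BeadPos i inner (csuc^ 1 (a i))
  u₁-inner = arcAB-inner i (s≤s z≤n) (span≥2 i)

  u₂-inner : BeadPos i inner (csuc^ 1 (b i))
  u₂-inner = arcBA-inner i (s≤s z≤n) (co-span≥2 i)

  v-inner : BeadPos (csuc i) inner (csuc^ 1 (a (csuc i)))
  v-inner = arcAB-inner (csuc i) (s≤s z≤n) (span≥2 (csuc i))

  u₂-steps : ∀ {t} → t < ℓ i → bead i (csuc^ t (a i)) ≡ u₂ → t ≡ suc (span i)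
  u₂-steps t<ℓ eq = csuc^-injective (a i) t<ℓ suc-span<ℓ (trans (bead-injective i eq) (cong csuc (sym (csuc^-span i))))
    where
      suc-span<ℓ : suc (span i) < ℓ i
      suc-span<ℓ = subst (suc (span i) <_) (m+[n∸m]≡n (<⇒≤ (span<ℓ i)))
                     (subst (_≤ span i + co-span i) (+-comm (span i) 2) (+-monoʳ-≤ (span i) (co-span≥2 i)))

  u₁≢u₂ : u₁ ≢ u₂
  u₁≢u₂ eq = contradiction (subst (2 ≤_) span≡0 (span≥2 i)) λ ()
    where
      span≡0 : span i ≡ 0
      span≡0 = sym (suc-injective (u₂-steps (<-trans (span≥2 i) (span<ℓ i)) eq))

  u₂∉arcAB : ¬ Interior S (arcAB i) u₂
  u₂∉arcAB (t , _ , t<span , eq) = <-asym t<span (subst (span i <_) (sym (u₂-steps (<-trans t<span (span<ℓ i)) eq)) (n<1+n _))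

  v∉arcAB : ¬ Interior S (arcAB i) v
  v∉arcAB (t , 0<t , t<span , eq) = inner-next-bead (arcAB-inner i 0<t t<span) v-inner eq

  v∉arcBA : ¬ Interior S (arcBA i) v
  v∉arcBA (t , 0<t , t<co-span , eq) = inner-next-bead (arcBA-inner i 0<t t<co-span) v-inner eq

  disconnected : Disconnected∖ G S
  disconnected with w ≟ᶠ u₁ | w ≟ᶠ u₂
  ... | yes w≡u₁ | _ =
    bare-path-separates S (arcBA i) b∈S (subst (_∈ S) (sym (arcBA-end i)) a∈S) (co-span≥2 i)
      (inner-∉S u₂-inner λ u₂≡w → u₁≢u₂ (sym (trans u₂≡w w≡u₁)))
      (inner-∉S v-inner λ v≡w → inner-next-bead u₁-inner v-inner (sym (trans v≡w w≡u₁))) v∉arcBA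
  ... | no w≢u₁ | yes w≡u₂ =
    bare-path-separates S (arcAB i) a∈S (subst (_∈ S) (sym (arcAB-end i)) b∈S) (span≥2 i)
      (inner-∉S u₁-inner (≢-sym w≢u₁)) (inner-∉S v-inner λ v≡w → inner-next-bead u₂-inner v-inner (sym (trans v≡w w≡u₂))) v∉arcAB
  ... | no w≢u₁ | no w≢u₂ =
    bare-path-separates S (arcAB i) a∈S (subst (_∈ S) (sym (arcAB-end i)) b∈S) (span≥2 i)
      (inner-∉S u₁-inner (≢-sym w≢u₁)) (inner-∉S u₂-inner (≢-sym w≢u₂)) u₂∉arcAB

  star-cutset : HasStarCutset G
  star-cutset = S , disconnected , w , w∈S , w-centre

mainTheorem12 : ∀ {n : ℕ} (G : Graph n) (N : Necklace G) →
                  HasStarCutset G ⇔ HasShortBead N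
mainTheorem12 G N = mk⇔ (star-cutset⇒short-bead N) λ (i , _ , a~w , w~b) → ShortBead.star-cutset N i a~w w~b
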